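{- Let $p$ be the mesh pattern $(12,R)$ with $R=\{(0,0),(0,1),(1,1),(1,2),(2,0),(2,2)\}$, let $E(t,u)=\sum_{n\ge0}t^n\sum_{\sigma\in K_n}u^{p(\sigma)}$, and let $P(t)=\sum_{n\ge0}|K_n(p)|t^n$. Then $$P(t)=\left(1+t^2-\frac{t^2A(t)^2}{(1+t)^2}\right)A(t),\qquad E(t,u)=\left(1+t^2(1-u)\Big(1-\frac{A(t)^2}{(1+t)^2}\Big)\right)A(t).$$ The initial terms of $E(t,u)$ are $1+t+2t^4+14t^5+(86+4u)t^6+(618+28u)t^7+(5062+180u)t^8+\cdots$.
   Context: A permutation $\sigma=\sigma_1\cdots\sigma_n$ of $\{1,\dots,n\}$ is a king permutation if $|\sigma_{i+1}-\sigma_i|>1$ for all $1\le i\le n-1$. $K_n$ is the set of king permutations of length $n$ ($K_0$ = the empty permutation, $K_1=\{1\}$) and $A(t)=\sum_{n\ge0}|K_n|t^n$ (known to equal $\sum_{n\ge0}n!\,t^n(1-t)^n/(1+t)^n$). For a mesh pattern $p=(12,R)$ with $R\subseteq\{0,1,2\}^2$, an occurrence of $p$ in $\sigma\in S_n$ is a pair of positions $i_1<i_2$ with $\sigma_{i_1}<\sigma_{i_2}$ such that for every $(x,y)\in R$ there is no position $m$ with $i_x<m<i_{x+1}$ and $v_y<\sigma_m<v_{y+1}$, where $i_0=0$, $i_3=n+1$, $v_0=0$, $v_1=\sigma_{i_1}$, $v_2=\sigma_{i_2}$, $v_3=n+1$ (first coordinate of a box indexes positions, second values). $p(\sigma)$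 is the number of occurrences of $p$ in $\sigma$; $K_n(p)$ is the set of king $n$-permutations with $p(\sigma)=0$. -}

module Defs where

open import Data.Nat as ℕ using (ℕ; zero; suc; _∸_; _<ᵇ_; _≡ᵇ_)
open import Data.Bool using (Bool; true; false; _∧_; _∨_; not)
open import Data.List using (List; []; _∷_; [_]; length; map; filter; concatMap; upTo)
open import Data.Bool.ListAction using (any; all)
open import Data.Fin using (Fin; toℕ) renaming (zero to f0; suc to fs)
open import Data.Product using (_×_; _,_)
open import Data.Integer as ℤ using (ℤ; +_)

-- Permutations, represented as lists σ₁ ⋯ σₙ of their values in {1,…,n}

range : ℕ → List ℕ
range n = map suc (upTo n)

-- 1-indexed lookup: at σ i = σᵢ  (0 if i is out of range)
at : List ℕ → ℕ → ℕ
at []       _             = 0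
at (x ∷ xs) zero          = 0
at (x ∷ xs) (suc zero)    = x
at (x ∷ xs) (suc (suc i)) = at xs (suc i)

words : ℕ → ℕ → List (List ℕ)
words n zero    = [ [] ]
words n (suc k) = concatMap (λ w → map (λ a → a ∷ w) (range n)) (words n k)

distinct : List ℕ → Bool
distinct []       = true
distinct (x ∷ xs) = not (any (λ y → x ≡ᵇ y) xs) ∧ distinct xs

Sn : ℕ → List (List ℕ)
Sn n = filter (λ σ → distinct σ Data.Bool.≟ true) (words n n)

farApart : ℕ → ℕ → Bool
farApart a b = (suc a <ᵇ b) ∨ (suc b <ᵇ a)

isKing : List ℕ → Bool
isKing (x ∷ y ∷ r) = farApart x y ∧ isKing (y ∷ r)
isKing _           = true

Kn : ℕ → List (List ℕ)
Kn n = filter (λ σ → isKing σ Data.Bool.≟ true) (Sn n)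

-- Mesh patterns (12, R), R ⊆ {0,1,2}²

MeshR : Set
MeshR = List (Fin 3 × Fin 3)

-- Is (i₁,i₂) an occurrence of the mesh pattern (12,R) in σ (positions 1-indexed)?
occurs : MeshR → List ℕ → ℕ → ℕ → Bool
occurs R σ i₁ i₂ = (i₁ <ᵇ i₂) ∧ (at σ i₁ <ᵇ at σ i₂) ∧ all boxEmpty R
  where
  n = length σ
  ii : ℕ → ℕ
  ii 0 = 0
  ii 1 = i₁
  ii 2 = i₂
  ii _ = suc n
  vv : ℕ → ℕ
  vv 0 = 0
  vv 1 = at σ i₁
  vv 2 = at σ i₂
  vv _ = suc n
  boxEmpty : Fin 3 × Fin 3 → Bool
  boxEmpty (x , y) = not (any (λ m → (ii (toℕ x) <ᵇ m) ∧ (m <ᵇ ii (suc (toℕ x)))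
                                    ∧ (vv (toℕ y) <ᵇ at σ m) ∧ (at σ m <ᵇ vv (suc (toℕ y))))
                              (range n))

patCount : MeshR → List ℕ → ℕ
patCount R σ = length (filter (λ { (i₁ , i₂) → occurs R σ i₁ i₂ Data.Bool.≟ true })
                              (concatMap (λ a → map (λ b → a , b) (range n)) (range n)))
  where n = length σ

Rp : MeshR
Rp = (f0 , f0) ∷ (f0 , f1) ∷ (f1 , f1) ∷ (f1 , f2) ∷ (f2 , f0) ∷ (f2 , f2) ∷ []
  where
  f1 f2 : Fin 3
  f1 = fs f0
  f2 = fs (fs f0)

kingDist : ℕ → ℕ → ℕ
kingDist n k = length (filter (λ σ → (patCount Rp σ ≡ᵇ k) Data.Bool.≟ true) (Kn n))

kingAvoid : ℕ → ℕ
kingAvoid n = length (filter (λ σ → (patCount Rp σ ≡ᵇ 0) Data.Bool.≟ true) (Kn n))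

-- Formal power series over ℤ: univariate in t, and bivariate in t,u
-- (f n = [tⁿ] f ;  F n k = [tⁿ uᵏ] F)

Series : Set
Series = ℕ → ℤ

BSeries : Set
BSeries = ℕ → ℕ → ℤ

sumTo : ℕ → (ℕ → ℤ) → ℤ
sumTo zero    f = f 0
sumTo (suc n) f = sumTo n f ℤ.+ f (suc n)

infixl 6 _⊕_ _⊖_ _⊕₂_ _⊖₂_
infixl 7 _⊗_ _⊗₂_

_⊕_ _⊖_ _⊗_ : Series → Series → Series
(f ⊕ g) n = f n ℤ.+ g n
(f ⊖ g) n = f n ℤ.- g n
(f ⊗ g) n = sumTo n (λ i → f i ℤ.* g (n ∸ i))

_⊕₂_ _⊖₂_ _⊗₂_ : BSeries → BSeries → BSeries
(F ⊕₂ G) n k = F n k ℤ.+ G n k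
(F ⊖₂ G) n k = F n k ℤ.- G n k
(F ⊗₂ G) n k = sumTo n (λ i → sumTo k (λ j → F i j ℤ.* G (n ∸ i) (k ∸ j)))

one tS : Series
one zero    = + 1
one (suc _) = + 0
tS 1 = + 1
tS _ = + 0

ι : Series → BSeries
ι f n zero    = f n
ι f n (suc _) = + 0

uS : BSeries
uS zero 1 = + 1
uS _    _ = + 0

-- 1/(1+t)² = Σₙ (-1)ⁿ (n+1) tⁿ
sgn : ℕ → ℤ
sgn zero    = + 1
sgn (suc n) = ℤ.- sgn n

inv1pt² : Series
inv1pt² n = sgn n ℤ.* + suc n

A : Series
A n = + length (Kn n)

E : BSeries
E n k = + kingDist n k

P : Series
P n = + kingAvoid n

module Submission where

-- A king permutation contains at most one occurrence of p, and an occurrence at positions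
-- i < j means that σ = P a M b R (a = σ_i, b = σ_j) with every letter of P above b, every
-- letter of M below a and every letter of R strictly between a and b.  Counting letters forces
-- P, aM and bR to fill the value intervals (b, n], [1, a] and (a, b], so σ is the skew sum
-- L ⊖ (X ⊕ Y) of a king permutation L with two king permutations X, Y that begin with their
-- maximum; conversely every such triple glues to a king permutation with exactly one
-- occurrence, except X = Y = 1, where a and b would be adjacent values.
-- If D(t) counts king permutations beginning with their maximum, deleting that maximum gives
-- (1 + t) D = t A.  Hence the king permutations with one occurrence are counted by
-- A (D² − t²) = (t² A² / (1 + t)² − t²) A, and those avoiding p by A minus this.

open import Defs
open import Data.Nat using (ℕ)
open import Data.Product using (_×_)
open import Relation.Binary.PropositionalEquality using (_≡_)

module PowerSeries where

  open import Data.Nat as ℕ using (ℕ; zero; suc; _∸_; _≤_; _<_; z≤n; s≤s)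
  import Data.Nat.Properties as ℕ
  open import Data.Integer using (ℤ; +_; _+_; _*_; -_; _-_)
  import Data.Integer.Properties as ℤ
  open import Data.Integer.Solver using (module +-*-Solver)
  open import Relation.Binary.PropositionalEquality
  open import Relation.Nullary using (contradiction)
  import Relation.Binary.Reasoning.Setoid as SetoidReasoning

  module ≗-Reasoning = SetoidReasoning (ℕ →-setoid ℤ)

  sumTo-cong : ∀ n {F G : ℕ → ℤ} → (∀ i → i ≤ n → F i ≡ G i) → sumTo n F ≡ sumTo n G
  sumTo-cong zero    F≡G = F≡G 0 z≤n
  sumTo-cong (suc n) F≡G =
    cong₂ _+_ (sumTo-cong n (λ i i≤n → F≡G i (ℕ.m≤n⇒m≤1+n i≤n))) (F≡G (suc n) ℕ.≤-refl)

  sumTo-suc : ∀ n (F : ℕ → ℤ) → sumTo (suc n) F ≡ F 0 + sumTo n (λ i → F (suc i))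
  sumTo-suc zero    F = refl
  sumTo-suc (suc n) F = begin
    sumTo (suc n) F + F (suc (suc n))                 ≡⟨ cong (_+ F (suc (suc n))) (sumTo-suc n F) ⟩
    F 0 + sumTo n (λ i → F (suc i)) + F (suc (suc n)) ≡⟨ ℤ.+-assoc (F 0) _ _ ⟩
    F 0 + (sumTo n (λ i → F (suc i)) + F (suc (suc n))) ∎
    where open ≡-Reasoning

  sumTo-+ : ∀ n (F G : ℕ → ℤ) → sumTo n (λ i → F i + G i) ≡ sumTo n F + sumTo n G
  sumTo-+ zero    F G = refl
  sumTo-+ (suc n) F G = begin
    sumTo n (λ i → F i + G i) + (F (suc n) + G (suc n)) ≡⟨ cong (_+ (F (suc n) + G (suc n))) (sumTo-+ n F G) ⟩
    sumTo n F + sumTo n G + (F (suc n) + G (suc n))     ≡⟨ interchange (sumTo n F) (sumTo n G) (F (suc n)) (G (suc n)) ⟩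
    sumTo n F + F (suc n) + (sumTo n G + G (suc n))     ∎
    where
    open ≡-Reasoning
    open +-*-Solver
    interchange : ∀ a b c d → a + b + (c + d) ≡ a + c + (b + d)
    interchange = solve 4 (λ a b c d → a :+ b :+ (c :+ d) := a :+ c :+ (b :+ d)) refl

  sumTo-neg : ∀ n (F : ℕ → ℤ) → sumTo n (λ i → - F i) ≡ - sumTo n F
  sumTo-neg zero    F = refl
  sumTo-neg (suc n) F =
    trans (cong (_+ - F (suc n)) (sumTo-neg n F)) (sym (ℤ.neg-distrib-+ (sumTo n F) (F (suc n))))

  sumTo-minus : ∀ n (F G : ℕ → ℤ) → sumTo n (λ i → F i - G i) ≡ sumTo n F - sumTo n G
  sumTo-minus n F G = trans (sumTo-+ n F (λ i → - G i)) (cong (λ x → sumTo n F + x) (sumTo-neg n G))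

  sumTo-*ˡ : ∀ n c (F : ℕ → ℤ) → sumTo n (λ i → c * F i) ≡ c * sumTo n F
  sumTo-*ˡ zero    c F = refl
  sumTo-*ˡ (suc n) c F =
    trans (cong (_+ c * F (suc n)) (sumTo-*ˡ n c F)) (sym (ℤ.*-distribˡ-+ c (sumTo n F) (F (suc n))))

  sumTo-zero : ∀ n (F : ℕ → ℤ) → (∀ i → i ≤ n → F i ≡ + 0) → sumTo n F ≡ + 0
  sumTo-zero zero    F F≡0 = F≡0 0 z≤n
  sumTo-zero (suc n) F F≡0 =
    cong₂ _+_ (sumTo-zero n F (λ i i≤n → F≡0 i (ℕ.m≤n⇒m≤1+n i≤n))) (F≡0 (suc n) ℕ.≤-refl)

  sumTo-reverse : ∀ n (F : ℕ → ℤ) → sumTo n F ≡ sumTo n (λ i → F (n ∸ i))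
  sumTo-reverse zero    F = refl
  sumTo-reverse (suc n) F = begin
    sumTo n F + F (suc n)                   ≡⟨ ℤ.+-comm (sumTo n F) (F (suc n)) ⟩
    F (suc n) + sumTo n F                   ≡⟨ cong (λ x → F (suc n) + x) (sumTo-reverse n F) ⟩
    F (suc n) + sumTo n (λ i → F (n ∸ i))   ≡⟨ sym (sumTo-suc n (λ i → F (suc n ∸ i))) ⟩
    sumTo (suc n) (λ i → F (suc n ∸ i))     ∎
    where open ≡-Reasoning

  sumTo-last : ∀ n (F : ℕ → ℤ) → (∀ i → i < n → F i ≡ + 0) → sumTo n F ≡ F n
  sumTo-last zero    F F≡0 = refl
  sumTo-last (suc n) F F≡0 = trans (cong (_+ F (suc n)) (sumTo-zero n F (λ i i≤n → F≡0 i (s≤s i≤n))))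
                                   (ℤ.+-identityˡ (F (suc n)))

  sumTo-first : ∀ n (F : ℕ → ℤ) → (∀ i → F (suc i) ≡ + 0) → sumTo n F ≡ F 0
  sumTo-first zero    F F≡0 = refl
  sumTo-first (suc n) F F≡0 = trans (sumTo-suc n F)
    (trans (cong (λ x → F 0 + x) (sumTo-zero n _ (λ i _ → F≡0 i))) (ℤ.+-identityʳ (F 0)))

  neg : Series → Series
  neg f n = - f n

  shift : Series → Series
  shift f n = f (suc n)

  scale : ℤ → Series → Series
  scale c f n = c * f n

  ⊕-cong : ∀ {f f′ g g′} → f ≗ f′ → g ≗ g′ → f ⊕ g ≗ f′ ⊕ g′
  ⊕-cong f≗f′ g≗g′ n = cong₂ _+_ (f≗f′ n) (g≗g′ n)

  ⊕-congʳ : ∀ f {g g′} → g ≗ g′ → f ⊕ g ≗ f ⊕ g′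
  ⊕-congʳ f g≗g′ n = cong (λ x → f n + x) (g≗g′ n)

  ⊖-cong : ∀ {f f′ g g′} → f ≗ f′ → g ≗ g′ → f ⊖ g ≗ f′ ⊖ g′
  ⊖-cong f≗f′ g≗g′ n = cong₂ _-_ (f≗f′ n) (g≗g′ n)

  ⊗-cong : ∀ {f f′ g g′} → f ≗ f′ → g ≗ g′ → f ⊗ g ≗ f′ ⊗ g′
  ⊗-cong f≗f′ g≗g′ n = sumTo-cong n (λ i _ → cong₂ _*_ (f≗f′ i) (g≗g′ (n ∸ i)))

  ⊗-congˡ : ∀ {f f′} g → f ≗ f′ → f ⊗ g ≗ f′ ⊗ g
  ⊗-congˡ {f} {f′} g f≗f′ = ⊗-cong {f} {f′} {g} {g} f≗f′ (λ _ → refl)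

  ⊗-congʳ : ∀ f {g g′} → g ≗ g′ → f ⊗ g ≗ f ⊗ g′
  ⊗-congʳ f {g} {g′} g≗g′ = ⊗-cong {f} {f} {g} {g′} (λ _ → refl) g≗g′

  ⊗-comm : ∀ f g → f ⊗ g ≗ g ⊗ f
  ⊗-comm f g n = begin
    sumTo n (λ i → f i * g (n ∸ i))               ≡⟨ sumTo-reverse n _ ⟩
    sumTo n (λ i → f (n ∸ i) * g (n ∸ (n ∸ i)))   ≡⟨ sumTo-cong n swap ⟩
    sumTo n (λ i → g i * f (n ∸ i))               ∎
    where
    open ≡-Reasoning
    swap : ∀ i → i ≤ n → f (n ∸ i) * g (n ∸ (n ∸ i)) ≡ g i * f (n ∸ i)
    swap i i≤n = trans (cong (λ j → f (n ∸ i) * g j) (ℕ.m∸[m∸n]≡n i≤n)) (ℤ.*-comm (f (n ∸ i)) (g i))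

  ⊗-distribʳ-⊕ : ∀ f g h → (f ⊕ g) ⊗ h ≗ f ⊗ h ⊕ g ⊗ h
  ⊗-distribʳ-⊕ f g h n = trans (sumTo-cong n (λ i _ → ℤ.*-distribʳ-+ (h (n ∸ i)) (f i) (g i))) (sumTo-+ n _ _)

  ⊗-negˡ : ∀ f g → neg f ⊗ g ≗ neg (f ⊗ g)
  ⊗-negˡ f g n = trans (sumTo-cong n (λ i _ → sym (ℤ.neg-distribˡ-* (f i) (g (n ∸ i))))) (sumTo-neg n _)

  ⊗-distribʳ-⊖ : ∀ f g h → (f ⊖ g) ⊗ h ≗ f ⊗ h ⊖ g ⊗ h
  ⊗-distribʳ-⊖ f g h n = trans (⊗-distribʳ-⊕ f (neg g) h n) (cong (λ x → (f ⊗ h) n + x) (⊗-negˡ g h n))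

  ⊗-distribˡ-⊖ : ∀ f g h → f ⊗ (g ⊖ h) ≗ f ⊗ g ⊖ f ⊗ h
  ⊗-distribˡ-⊖ f g h n = begin
    (f ⊗ (g ⊖ h)) n         ≡⟨ ⊗-comm f (g ⊖ h) n ⟩
    ((g ⊖ h) ⊗ f) n         ≡⟨ ⊗-distribʳ-⊖ g h f n ⟩
    (g ⊗ f ⊖ h ⊗ f) n       ≡⟨ cong₂ _-_ (⊗-comm g f n) (⊗-comm h f n) ⟩
    (f ⊗ g ⊖ f ⊗ h) n       ∎
    where open ≡-Reasoning

  ⊗-scaleˡ : ∀ c f g → scale c f ⊗ g ≗ scale c (f ⊗ g)
  ⊗-scaleˡ c f g n = trans (sumTo-cong n (λ i _ → ℤ.*-assoc c (f i) (g (n ∸ i)))) (sumTo-*ˡ n c _)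

  ⊗-suc : ∀ f g n → (f ⊗ g) (suc n) ≡ f 0 * g (suc n) + (shift f ⊗ g) n
  ⊗-suc f g n = sumTo-suc n (λ i → f i * g (suc n ∸ i))

  shift-⊗ : ∀ f g → shift (f ⊗ g) ≗ scale (f 0) (shift g) ⊕ shift f ⊗ g
  shift-⊗ = ⊗-suc

  ⊗-assoc : ∀ f g h → (f ⊗ g) ⊗ h ≗ f ⊗ (g ⊗ h)
  ⊗-assoc f g h zero    = ℤ.*-assoc (f 0) (g 0) (h 0)
  ⊗-assoc f g h (suc n) = begin
    ((f ⊗ g) ⊗ h) (suc n)
      ≡⟨ ⊗-suc (f ⊗ g) h n ⟩
    f 0 * g 0 * h (suc n) + (shift (f ⊗ g) ⊗ h) n
      ≡⟨ cong (λ x → a + x) (⊗-congˡ h (shift-⊗ f g) n) ⟩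
    a + ((scale (f 0) (shift g) ⊕ shift f ⊗ g) ⊗ h) n
      ≡⟨ cong (λ x → a + x) (⊗-distribʳ-⊕ (scale (f 0) (shift g)) (shift f ⊗ g) h n) ⟩
    a + ((scale (f 0) (shift g) ⊗ h) n + ((shift f ⊗ g) ⊗ h) n)
      ≡⟨ cong₂ (λ x y → a + (x + y)) (⊗-scaleˡ (f 0) (shift g) h n) (⊗-assoc (shift f) g h n) ⟩
    f 0 * g 0 * h (suc n) + (f 0 * (shift g ⊗ h) n + (shift f ⊗ (g ⊗ h)) n)
      ≡⟨ regroup (f 0) (g 0) (h (suc n)) ((shift g ⊗ h) n) ((shift f ⊗ (g ⊗ h)) n) ⟩
    f 0 * (g 0 * h (suc n) + (shift g ⊗ h) n) + (shift f ⊗ (g ⊗ h)) n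
      ≡⟨ cong (λ x → f 0 * x + (shift f ⊗ (g ⊗ h)) n) (sym (⊗-suc g h n)) ⟩
    f 0 * (g ⊗ h) (suc n) + (shift f ⊗ (g ⊗ h)) n
      ≡⟨ sym (⊗-suc f (g ⊗ h) n) ⟩
    (f ⊗ (g ⊗ h)) (suc n) ∎
    where
    open ≡-Reasoning
    open +-*-Solver
    a = f 0 * g 0 * h (suc n)
    regroup : ∀ x y z u v → x * y * z + (x * u + v) ≡ x * (y * z + u) + v
    regroup = solve 5 (λ x y z u v → x :* y :* z :+ (x :* u :+ v) := x :* (y :* z :+ u) :+ v) refl

  ⊗-zeroˡ : ∀ f g → f ≗ (λ _ → + 0) → f ⊗ g ≗ (λ _ → + 0)
  ⊗-zeroˡ f g f≗0 n = sumTo-zero n _ (λ i _ → trans (cong (_* g (n ∸ i)) (f≗0 i)) (ℤ.*-zeroˡ (g (n ∸ i))))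

  ⊗-identityˡ : ∀ f → one ⊗ f ≗ f
  ⊗-identityˡ f zero    = ℤ.*-identityˡ (f 0)
  ⊗-identityˡ f (suc n) = begin
    (one ⊗ f) (suc n)                   ≡⟨ ⊗-suc one f n ⟩
    + 1 * f (suc n) + (shift one ⊗ f) n ≡⟨ cong₂ _+_ (ℤ.*-identityˡ (f (suc n))) (⊗-zeroˡ (shift one) f (λ _ → refl) n) ⟩
    f (suc n) + + 0                     ≡⟨ ℤ.+-identityʳ (f (suc n)) ⟩
    f (suc n)                           ∎
    where open ≡-Reasoning

  ⊗-identityʳ : ∀ f → f ⊗ one ≗ f
  ⊗-identityʳ f n = trans (⊗-comm f one n) (⊗-identityˡ f n)

  tS-⊗-suc : ∀ f n → (tS ⊗ f) (suc n) ≡ f n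
  tS-⊗-suc f n = begin
    (tS ⊗ f) (suc n)                   ≡⟨ ⊗-suc tS f n ⟩
    + 0 * f (suc n) + (shift tS ⊗ f) n ≡⟨ cong (λ x → + 0 * f (suc n) + x) (⊗-congˡ f shift-tS n) ⟩
    + 0 + (one ⊗ f) n                  ≡⟨ ℤ.+-identityˡ _ ⟩
    (one ⊗ f) n                        ≡⟨ ⊗-identityˡ f n ⟩
    f n                                ∎
    where
    open ≡-Reasoning
    shift-tS : shift tS ≗ one
    shift-tS zero    = refl
    shift-tS (suc n) = refl

  1+t : Series
  1+t = one ⊕ tS

  1+t-⊗-zero : ∀ f → (1+t ⊗ f) 0 ≡ f 0
  1+t-⊗-zero f = trans (⊗-distribʳ-⊕ one tS f 0) (trans (cong (_+ + 0) (⊗-identityˡ f 0)) (ℤ.+-identityʳ (f 0)))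

  1+t-⊗-suc : ∀ f n → (1+t ⊗ f) (suc n) ≡ f (suc n) + f n
  1+t-⊗-suc f n = trans (⊗-distribʳ-⊕ one tS f (suc n)) (cong₂ _+_ (⊗-identityˡ f (suc n)) (tS-⊗-suc f n))

  1+t-⊗-sgn : 1+t ⊗ sgn ≗ one
  1+t-⊗-sgn zero    = 1+t-⊗-zero sgn
  1+t-⊗-sgn (suc n) = trans (1+t-⊗-suc sgn n) (ℤ.+-inverseˡ (sgn n))

  1+t-⊗-inv1pt² : 1+t ⊗ inv1pt² ≗ sgn
  1+t-⊗-inv1pt² zero    = 1+t-⊗-zero inv1pt²
  1+t-⊗-inv1pt² (suc n) = begin
    (1+t ⊗ inv1pt²) (suc n)          ≡⟨ 1+t-⊗-suc inv1pt² n ⟩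
    - sgn n * + suc (suc n) + sgn n * + suc n
                                     ≡⟨ cong (λ x → - sgn n * x + sgn n * + suc n) (ℤ.pos-+ 1 (suc n)) ⟩
    - sgn n * (+ 1 + + suc n) + sgn n * + suc n
                                     ≡⟨ telescope (sgn n) (+ suc n) ⟩
    - sgn n                          ∎
    where
    open ≡-Reasoning
    open +-*-Solver
    telescope : ∀ s x → - s * (+ 1 + x) + s * x ≡ - s
    telescope = solve 2 (λ s x → :- s :* (con (+ 1) :+ x) :+ s :* x := :- s) refl

  1+t-⊗⁻¹ : ∀ f g → 1+t ⊗ f ≗ g → f ≗ sgn ⊗ g
  1+t-⊗⁻¹ f g 1+t⊗f≗g = begin
    f                   ≈⟨ ⊗-identityˡ f ⟨
    one ⊗ f             ≈⟨ ⊗-congˡ f 1+t-⊗-sgn ⟨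
    (1+t ⊗ sgn) ⊗ f     ≈⟨ ⊗-congˡ f (⊗-comm 1+t sgn) ⟩
    (sgn ⊗ 1+t) ⊗ f     ≈⟨ ⊗-assoc sgn 1+t f ⟩
    sgn ⊗ (1+t ⊗ f)     ≈⟨ ⊗-congʳ sgn 1+t⊗f≗g ⟩
    sgn ⊗ g             ∎
    where open ≗-Reasoning

  inv1pt²≗sgn⊗sgn : inv1pt² ≗ sgn ⊗ sgn
  inv1pt²≗sgn⊗sgn = 1+t-⊗⁻¹ inv1pt² sgn 1+t-⊗-inv1pt²

  ⊗-interchange : ∀ a b c d → (a ⊗ b) ⊗ (c ⊗ d) ≗ (a ⊗ c) ⊗ (b ⊗ d)
  ⊗-interchange a b c d = begin
    (a ⊗ b) ⊗ (c ⊗ d)    ≈⟨ ⊗-assoc a b (c ⊗ d) ⟩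
    a ⊗ (b ⊗ (c ⊗ d))    ≈⟨ ⊗-congʳ a (⊗-assoc b c d) ⟨
    a ⊗ ((b ⊗ c) ⊗ d)    ≈⟨ ⊗-congʳ a (⊗-congˡ d (⊗-comm b c)) ⟩
    a ⊗ ((c ⊗ b) ⊗ d)    ≈⟨ ⊗-congʳ a (⊗-assoc c b d) ⟩
    a ⊗ (c ⊗ (b ⊗ d))    ≈⟨ ⊗-assoc a c (b ⊗ d) ⟨
    (a ⊗ c) ⊗ (b ⊗ d)    ∎
    where open ≗-Reasoning

  column : BSeries → ℕ → Series
  column F k n = F n k

  u-free : BSeries → Set
  u-free F = ∀ n k → F n (suc k) ≡ + 0

  column-⊗₂-u-freeʳ : ∀ F G → u-free G → ∀ k → column (F ⊗₂ G) k ≗ column F k ⊗ column G 0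
  column-⊗₂-u-freeʳ F G G-u-free k n = sumTo-cong n (λ i _ → trans
    (sumTo-last k _ (λ j j<k → trans (cong (F i j *_) (u-free-at (n ∸ i) (ℕ.m>n⇒m∸n≢0 j<k))) (ℤ.*-zeroʳ (F i j))))
    (cong (λ x → F i k * G (n ∸ i) x) (ℕ.n∸n≡0 k)))
    where
    u-free-at : ∀ m {l} → l ≢ 0 → G m l ≡ + 0
    u-free-at m {zero}  l≢0 = contradiction refl l≢0
    u-free-at m {suc l} _   = G-u-free m l

  column-⊗₂-u-freeˡ : ∀ F G → u-free F → ∀ k → column (F ⊗₂ G) k ≗ column F 0 ⊗ column G k
  column-⊗₂-u-freeˡ F G F-u-free k n = sumTo-cong n (λ i _ → sumTo-first k _ (λ j →
    trans (cong (_* G (n ∸ i) (k ∸ suc j)) (F-u-free i j)) (ℤ.*-zeroˡ (G (n ∸ i) (k ∸ suc j)))))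

module KingPermutations where

  open import Data.Nat as ℕ using (ℕ; zero; suc; 2+; _+_; _∸_; _≤_; _<_; z≤n; s≤s; _<ᵇ_; _≡ᵇ_)
  import Data.Nat.Properties as ℕ
  open import Data.Bool using (Bool; true; false; _∧_; not; if_then_else_)
  import Data.Bool as Bool
  import Data.Bool.Properties as Bool
  open import Data.Bool.ListAction using (any)
  open import Data.Empty using (⊥)
  open import Data.Product using (_×_; _,_; proj₁; proj₂; ∃; ∃₂; swap)
  open import Data.Sum using (inj₁; inj₂)
  open import Data.List using (List; []; _∷_; length; map; filter; concatMap; cartesianProduct; cartesianProductWith; upTo; _++_)
  import Data.List.Properties as List
  open import Data.List.Relation.Unary.All as All using (All; []; _∷_)
  import Data.List.Relation.Unary.All.Properties as All
  open import Data.List.Relation.Unary.Any using (here; there)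
  import Data.List.Relation.Unary.AllPairs as AllPairs
  open import Data.List.Relation.Unary.Unique.Propositional using (Unique; []; _∷_)
  import Data.List.Relation.Unary.Unique.Propositional.Properties as Unique
  open import Data.List.Relation.Binary.Subset.Propositional using (_⊆_)
  open import Data.List.Membership.Propositional using (_∈_; _∉_; lose)
  open import Data.List.Membership.Propositional.Properties
  open import Function using (_∘_; Equivalence)
  open import Level using (0ℓ)
  open import Relation.Binary.PropositionalEquality
  open import Relation.Binary.Definitions using (Tri; tri<; tri≈; tri>)
  open import Relation.Nullary using (¬_; contradiction)
  open import Relation.Unary using (Pred; Decidable)

  ∧-split : ∀ a {b} → a ∧ b ≡ true → a ≡ true × b ≡ true
  ∧-split true b≡true = refl , b≡true

  ∧-intro : ∀ {a b} → a ≡ true → b ≡ true → a ∧ b ≡ true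
  ∧-intro refl refl = refl

  not-true⁻ : ∀ {b} → not b ≡ true → b ≡ false
  not-true⁻ {false} _ = refl

  not-true⁺ : ∀ {b} → b ≡ false → not b ≡ true
  not-true⁺ refl = refl

  <ᵇ⇒< : ∀ {m n} → (m <ᵇ n) ≡ true → m < n
  <ᵇ⇒< {m} {n} m<ᵇn = ℕ.<ᵇ⇒< m n (Equivalence.from Bool.T-≡ m<ᵇn)

  <⇒<ᵇ : ∀ {m n} → m < n → (m <ᵇ n) ≡ true
  <⇒<ᵇ m<n = Equivalence.to Bool.T-≡ (ℕ.<⇒<ᵇ m<n)

  ≡ᵇ⇒≡ : ∀ {m n} → (m ≡ᵇ n) ≡ true → m ≡ n
  ≡ᵇ⇒≡ {m} {n} m≡ᵇn = ℕ.≡ᵇ⇒≡ m n (Equivalence.from Bool.T-≡ m≡ᵇn)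

  ≡⇒≡ᵇ : ∀ {m n} → m ≡ n → (m ≡ᵇ n) ≡ true
  ≡⇒≡ᵇ {m} {n} m≡n = Equivalence.to Bool.T-≡ (ℕ.≡⇒≡ᵇ m n m≡n)

  module _ {A : Set} (p : A → Bool) where

    any-false⁻ : ∀ xs → any p xs ≡ false → ∀ {x} → x ∈ xs → p x ≡ false
    any-false⁻ (y ∷ ys) none (here refl) with p y | none
    ... | false | _ = refl
    ... | true  | ()
    any-false⁻ (y ∷ ys) none (there x∈) with p y | none
    ... | false | none′ = any-false⁻ ys none′ x∈
    ... | true  | ()

    any-false⁺ : ∀ xs → (∀ {x} → x ∈ xs → p x ≡ false) → any p xs ≡ false
    any-false⁺ []       _    = refl
    any-false⁺ (y ∷ ys) none rewrite none (here refl) = any-false⁺ ys (λ x∈ → none (there x∈))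

    any-true⁺ : ∀ xs {x} → x ∈ xs → p x ≡ true → any p xs ≡ true
    any-true⁺ (y ∷ ys) (here refl) px rewrite px = refl
    any-true⁺ (y ∷ ys) (there x∈)  px with p y
    ... | true  = refl
    ... | false = any-true⁺ ys x∈ px

  InRange : ℕ → ℕ → Set
  InRange n a = 1 ≤ a × a ≤ n

  ∈-range⁺ : ∀ {n m} → InRange n m → m ∈ range n
  ∈-range⁺ {n} {suc m} (_ , m<n) = ∈-map⁺ suc (∈-upTo⁺ m<n)

  ∈-range⁻ : ∀ {n m} → m ∈ range n → InRange n m
  ∈-range⁻ m∈ with _ , i∈ , refl ← ∈-map⁻ suc m∈ = s≤s z≤n , ∈-upTo⁻ i∈

  Unique-range : ∀ n → Unique (range n)
  Unique-range n = Unique.map⁺ ℕ.suc-injective (Unique.upTo⁺ n)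

  length-range : ∀ n → length (range n) ≡ n
  length-range n = trans (List.length-map suc (upTo n)) (List.length-upTo n)

  concatMap-map : ∀ {A B C : Set} (f : A → B → C) xs ys →
                  concatMap (λ x → map (f x) ys) xs ≡ cartesianProductWith f xs ys
  concatMap-map f []       ys = refl
  concatMap-map f (x ∷ xs) ys = cong (map (f x) ys ++_) (concatMap-map f xs ys)

  module _ {A : Set} where

    remove : ∀ {x : A} ys → x ∈ ys → List A
    remove (y ∷ ys) (here _)  = ys
    remove (y ∷ ys) (there p) = y ∷ remove ys p

    length-remove : ∀ {x : A} ys (x∈ : x ∈ ys) → length ys ≡ suc (length (remove ys x∈))
    length-remove (y ∷ ys) (here _)  = refl
    length-remove (y ∷ ys) (there p) = cong suc (length-remove ys p)

    ∈-remove : ∀ {x z : A} ys (x∈ : x ∈ ys) → z ∈ ys → z ≢ x → z ∈ remove ys x∈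
    ∈-remove (y ∷ ys) (here refl) (here refl) z≢x = contradiction refl z≢x
    ∈-remove (y ∷ ys) (here refl) (there z∈)  _   = z∈
    ∈-remove (y ∷ ys) (there x∈)  (here refl) _   = here refl
    ∈-remove (y ∷ ys) (there x∈)  (there z∈)  z≢x = there (∈-remove ys x∈ z∈ z≢x)

    Unique-⊆⇒length≤ : ∀ {xs ys : List A} → Unique xs → xs ⊆ ys → length xs ≤ length ys
    Unique-⊆⇒length≤ {[]}     _            _    = z≤n
    Unique-⊆⇒length≤ {x ∷ xs} {ys} (x∉ ∷ u) x∷xs⊆ys =
      subst (suc (length xs) ≤_) (sym (length-remove ys x∈ys))
        (s≤s (Unique-⊆⇒length≤ u xs⊆ys-x))
      where
      x∈ys : x ∈ ys
      x∈ys = x∷xs⊆ys (here refl)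
      xs⊆ys-x : xs ⊆ remove ys x∈ys
      xs⊆ys-x z∈ = ∈-remove ys x∈ys (x∷xs⊆ys (there z∈)) (λ z≡x → All.lookup x∉ z∈ (sym z≡x))

    Unique-⊆⊇⇒length≡ : ∀ {xs ys : List A} → Unique xs → Unique ys → xs ⊆ ys → ys ⊆ xs → length xs ≡ length ys
    Unique-⊆⊇⇒length≡ uxs uys xs⊆ys ys⊆xs =
      ℕ.≤-antisym (Unique-⊆⇒length≤ uxs xs⊆ys) (Unique-⊆⇒length≤ uys ys⊆xs)

    Unique-++⁻ : ∀ (xs : List A) {ys} → Unique (xs ++ ys) → Unique xs × Unique ys
    Unique-++⁻ []       u        = [] , u
    Unique-++⁻ (x ∷ xs) (x∉ ∷ u) with uxs , uys ← Unique-++⁻ xs u =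
      All.tabulate (λ y∈ → All.lookup x∉ (∈-++⁺ˡ y∈)) ∷ uxs , uys

  Unique-between⇒length< : ∀ {lo hi} {xs : List ℕ} → lo < hi → Unique xs → All (λ v → lo < v × v < hi) xs →
                           lo + suc (length xs) ≤ hi
  Unique-between⇒length< {lo} {hi} {xs} lo<hi u bounds = begin
    lo + suc (length xs)               ≤⟨ ℕ.+-monoʳ-≤ lo (s≤s |xs|≤k) ⟩
    lo + suc k                         ≡⟨ ℕ.+-suc lo k ⟩
    suc lo + k                         ≡⟨ ℕ.m+[n∸m]≡n lo<hi ⟩
    hi                                 ∎
    where
    open ℕ.≤-Reasoning
    k = hi ∸ suc lo
    interval = map (lo +_) (range k)
    xs⊆interval : xs ⊆ interval
    xs⊆interval {v} v∈ with lo<v , v<hi ← All.lookup bounds v∈ =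
      subst (_∈ interval) (ℕ.m+[n∸m]≡n (ℕ.<⇒≤ lo<v)) (∈-map⁺ (lo +_) (∈-range⁺ (ℕ.m<n⇒0<n∸m lo<v , v-lo≤k)))
      where
      v-lo≤k : v ∸ lo ≤ k
      v-lo≤k = ℕ.m≤n+o⇒m∸n≤o v lo (ℕ.≤-pred (subst (v <_) (sym (ℕ.m+[n∸m]≡n lo<hi)) v<hi))
    |xs|≤k : length xs ≤ k
    |xs|≤k = ℕ.≤-trans (Unique-⊆⇒length≤ u xs⊆interval)
                       (ℕ.≤-reflexive (trans (List.length-map (lo +_) (range k)) (length-range k)))

  module _ {A : Set} {P : Pred A 0ℓ} (P? : Decidable P) where

    filter-length≤1 : ∀ {xs} → Unique xs → (∀ {x y} → x ∈ xs → y ∈ xs → P x → P y → x ≡ y) →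
                      length (filter P? xs) ≤ 1
    filter-length≤1 {xs} u P-unique = at-most-one (filter P? xs) (Unique.filter⁺ P? u) λ x∈ y∈ →
      let x∈xs , Px = ∈-filter⁻ P? {xs = xs} x∈ ; y∈xs , Py = ∈-filter⁻ P? {xs = xs} y∈ in P-unique x∈xs y∈xs Px Py
      where
      at-most-one : ∀ ys → Unique ys → (∀ {x y} → x ∈ ys → y ∈ ys → x ≡ y) → length ys ≤ 1
      at-most-one []           _            _       = z≤n
      at-most-one (x ∷ [])     _            _       = s≤s z≤n
      at-most-one (x ∷ y ∷ ys) (x∉ ∷ _) all-equal =
        contradiction (all-equal (here refl) (there (here refl))) (All.lookup x∉ (here refl))

    filter-nonempty : ∀ xs {k} → length (filter P? xs) ≡ suc k → ∃ λ x → x ∈ xs × P x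
    filter-nonempty xs _ with filter P? xs in eq
    ... | y ∷ _ = y , ∈-filter⁻ P? {xs = xs} (subst (y ∈_) (sym eq) (here refl))

  module _ {A : Set} (p q : A → Bool) where

    length-filter-complement : ∀ xs → (∀ {x} → x ∈ xs → q x ≡ not (p x)) →
      length (filter (λ x → p x Bool.≟ true) xs) + length (filter (λ x → q x Bool.≟ true) xs) ≡ length xs
    length-filter-complement []       _          = refl
    length-filter-complement (x ∷ xs) complement with p x | q x | complement (here refl)
                                                    | length-filter-complement xs (complement ∘ there)
    ... | true  | false | _ | ih = cong suc ih
    ... | false | true  | _ | ih = trans (ℕ.+-suc _ _) (cong suc ih)

  ++-injective : ∀ {A : Set} (xs ys xs′ ys′ : List A) → length xs ≡ length xs′ →
                 xs ++ ys ≡ xs′ ++ ys′ → xs ≡ xs′ × ys ≡ ys′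
  ++-injective []       ys []         ys′ _   eq = refl , eq
  ++-injective (x ∷ xs) ys (x′ ∷ xs′) ys′ len eq
    with refl , eq′ ← List.∷-injective eq
    with refl , refl ← ++-injective xs ys xs′ ys′ (ℕ.suc-injective len) eq′ = refl , refl

  Unique-map-injectiveOn : ∀ {A B : Set} (f : A → B) {xs} → Unique xs →
                           (∀ {x y} → x ∈ xs → y ∈ xs → f x ≡ f y → x ≡ y) → Unique (map f xs)
  Unique-map-injectiveOn f {[]}     []       _         = []
  Unique-map-injectiveOn f {x ∷ xs} (x∉ ∷ u) injective =
    All.tabulate fx∉ ∷ Unique-map-injectiveOn f u (λ x∈ y∈ → injective (there x∈) (there y∈))
    where
    fx∉ : ∀ {v} → v ∈ map f xs → f x ≢ v
    fx∉ v∈ fx≡v with y , y∈ , refl ← ∈-map⁻ f v∈ = All.lookup x∉ y∈ (injective (here refl) (there y∈) fx≡v)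

  length-cartesianProduct : ∀ {A B : Set} (xs : List A) (ys : List B) → length (cartesianProduct xs ys) ≡ length xs ℕ.* length ys
  length-cartesianProduct []       ys = refl
  length-cartesianProduct (x ∷ xs) ys =
    trans (List.length-++ (map (x ,_) ys)) (cong₂ _+_ (List.length-map (x ,_) ys) (length-cartesianProduct xs ys))

  words-suc : ∀ n k → words n (suc k) ≡ cartesianProductWith (λ w a → a ∷ w) (words n k) (range n)
  words-suc n k = concatMap-map (λ w a → a ∷ w) (words n k) (range n)

  ∈-words⁺ : ∀ n {w} → All (InRange n) w → w ∈ words n (length w)
  ∈-words⁺ n []                = here refl
  ∈-words⁺ n {a ∷ w} (a∈ ∷ w∈) = subst (a ∷ w ∈_) (sym (words-suc n (length w)))
    (∈-cartesianProductWith⁺ (λ w a → a ∷ w) (∈-words⁺ n w∈) (∈-range⁺ a∈))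

  ∈-words⁻ : ∀ n k {w} → w ∈ words n k → length w ≡ k × All (InRange n) w
  ∈-words⁻ n zero    (here refl) = refl , []
  ∈-words⁻ n (suc k) w∈
    with v , a , v∈ , a∈ , refl ← ∈-cartesianProductWith⁻ (λ w a → a ∷ w) (words n k) (range n)
                                    (subst (_ ∈_) (words-suc n k) w∈)
    with refl , v-in ← ∈-words⁻ n k v∈ = refl , ∈-range⁻ a∈ ∷ v-in

  Unique-words : ∀ n k → Unique (words n k)
  Unique-words n zero    = [] ∷ []
  Unique-words n (suc k) = subst Unique (sym (words-suc n k))
    (Unique.cartesianProductWith⁺ (λ w a → a ∷ w) (swap ∘ List.∷-injective) (Unique-words n k) (Unique-range n))

  distinct⇒Unique : ∀ σ → distinct σ ≡ true → Unique σ
  distinct⇒Unique []       _   = []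
  distinct⇒Unique (x ∷ xs) dis with x-fresh , xs-distinct ← ∧-split (not (any (x ≡ᵇ_) xs)) dis =
    All.¬Any⇒All¬ xs x∉xs ∷ distinct⇒Unique xs xs-distinct
    where
    x∉xs : x ∉ xs
    x∉xs x∈ = contradiction (trans (sym (any-true⁺ (x ≡ᵇ_) xs x∈ (≡⇒≡ᵇ {x} refl))) (not-true⁻ x-fresh)) λ ()

  Unique⇒distinct : ∀ σ → Unique σ → distinct σ ≡ true
  Unique⇒distinct []       _        = refl
  Unique⇒distinct (x ∷ xs) (x∉ ∷ u) = ∧-intro (not-true⁺ (any-false⁺ (x ≡ᵇ_) xs x≢)) (Unique⇒distinct xs u)
    where
    x≢ : ∀ {y} → y ∈ xs → (x ≡ᵇ y) ≡ false
    x≢ {y} y∈ with x ≡ᵇ y in x≡ᵇy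
    ... | false = refl
    ... | true  = contradiction (≡ᵇ⇒≡ x≡ᵇy) (All.lookup x∉ y∈)

  record IsPerm (n : ℕ) (σ : List ℕ) : Set where
    constructor isPerm
    field
      length≡ : length σ ≡ n
      unique  : Unique σ
      inRange : All (InRange n) σ

  ∈-Sn⁺ : ∀ {n σ} → IsPerm n σ → σ ∈ Sn n
  ∈-Sn⁺ {n} {σ} (isPerm refl u in-σ) =
    ∈-filter⁺ (λ σ → distinct σ Bool.≟ true) (∈-words⁺ n in-σ) (Unique⇒distinct σ u)

  ∈-Sn⁻ : ∀ {n σ} → σ ∈ Sn n → IsPerm n σ
  ∈-Sn⁻ {n} {σ} σ∈ with w∈ , dis ← ∈-filter⁻ (λ σ → distinct σ Bool.≟ true) {xs = words n n} σ∈
                   with len , in-σ ← ∈-words⁻ n n w∈ = isPerm len (distinct⇒Unique σ dis) in-σ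

  Unique-Sn : ∀ n → Unique (Sn n)
  Unique-Sn n = Unique.filter⁺ (λ σ → distinct σ Bool.≟ true) (Unique-words n n)

  ∈-Kn⁺ : ∀ {n σ} → IsPerm n σ → isKing σ ≡ true → σ ∈ Kn n
  ∈-Kn⁺ perm king = ∈-filter⁺ (λ σ → isKing σ Bool.≟ true) (∈-Sn⁺ perm) king

  ∈-Kn⁻ : ∀ {n σ} → σ ∈ Kn n → IsPerm n σ × isKing σ ≡ true
  ∈-Kn⁻ {n} σ∈ with σ∈Sn , king ← ∈-filter⁻ (λ σ → isKing σ Bool.≟ true) {xs = Sn n} σ∈ = ∈-Sn⁻ σ∈Sn , king

  Unique-Kn : ∀ n → Unique (Kn n)
  Unique-Kn n = Unique.filter⁺ (λ σ → isKing σ Bool.≟ true) (Unique-Sn n)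

  IsPerm-∷-max : ∀ {m τ} → IsPerm m (m ∷ τ) → All (λ v → 1 ≤ v × v < m) τ
  IsPerm-∷-max (isPerm _ (m∉ ∷ _) (_ ∷ in-τ)) =
    All.zipWith (λ { ((1≤v , v≤m) , m≢v) → 1≤v , ℕ.≤∧≢⇒< v≤m (m≢v ∘ sym) }) (in-τ , m∉)

  IsPerm-∷⁻ : ∀ {n τ} → IsPerm (suc n) (suc n ∷ τ) → IsPerm n τ
  IsPerm-∷⁻ perm@(isPerm len (_ ∷ u) _) =
    isPerm (ℕ.suc-injective len) u (All.map (λ (1≤v , v<n+1) → 1≤v , ℕ.≤-pred v<n+1) (IsPerm-∷-max perm))

  IsPerm-∷⁺ : ∀ {n τ} → IsPerm n τ → IsPerm (suc n) (suc n ∷ τ)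
  IsPerm-∷⁺ (isPerm len u in-τ) =
    isPerm (cong suc len) (All.¬Any⇒All¬ _ (λ n+1∈ → ℕ.<-irrefl refl (proj₂ (All.lookup in-τ n+1∈))) ∷ u)
           ((s≤s z≤n , ℕ.≤-refl) ∷ All.map (λ (1≤v , v≤n) → 1≤v , ℕ.m≤n⇒m≤1+n v≤n) in-τ)

  ∈-Kn⇒IsPerm : ∀ {n σ} → σ ∈ Kn n → IsPerm (length σ) σ
  ∈-Kn⇒IsPerm {n} σ∈ with perm , _ ← ∈-Kn⁻ {n} σ∈ with refl ← IsPerm.length≡ perm = perm

  at₀ : List ℕ → ℕ → ℕ
  at₀ σ k = at σ (suc k)

  at₀-++ˡ : ∀ xs ys {k} → k < length xs → at₀ (xs ++ ys) k ≡ at₀ xs k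
  at₀-++ˡ (x ∷ xs) ys {zero}  _         = refl
  at₀-++ˡ (x ∷ xs) ys {suc k} (s≤s k<n) = at₀-++ˡ xs ys k<n

  at₀-++ʳ : ∀ xs ys k → at₀ (xs ++ ys) (length xs + k) ≡ at₀ ys k
  at₀-++ʳ []       ys k = refl
  at₀-++ʳ (x ∷ xs) ys k = at₀-++ʳ xs ys k

  at₀-∈ : ∀ xs {k} → k < length xs → at₀ xs k ∈ xs
  at₀-∈ (x ∷ xs) {zero}  _         = here refl
  at₀-∈ (x ∷ xs) {suc k} (s≤s k<n) = there (at₀-∈ xs k<n)

  ∈⇒at₀ : ∀ xs {x} → x ∈ xs → ∃ λ k → k < length xs × at₀ xs k ≡ x
  ∈⇒at₀ (y ∷ ys) (here refl) = zero , s≤s z≤n , refl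
  ∈⇒at₀ (y ∷ ys) (there x∈) with k , k<n , refl ← ∈⇒at₀ ys x∈ = suc k , s≤s k<n , refl

  at₀-injective : ∀ {xs k k′} → Unique xs → k < length xs → k′ < length xs → at₀ xs k ≡ at₀ xs k′ → k ≡ k′
  at₀-injective {x ∷ xs} {zero}  {zero}   _        _         _          _  = refl
  at₀-injective {x ∷ xs} {zero}  {suc k′} (x∉ ∷ _) _         (s≤s k′<n) eq = contradiction eq (All.lookup x∉ (at₀-∈ xs k′<n))
  at₀-injective {x ∷ xs} {suc k} {zero}   (x∉ ∷ _) (s≤s k<n) _          eq = contradiction (sym eq) (All.lookup x∉ (at₀-∈ xs k<n))
  at₀-injective {x ∷ xs} {suc k} {suc k′} (_ ∷ u)  (s≤s k<n) (s≤s k′<n) eq = cong suc (at₀-injective u k<n k′<n eq)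

  inBox : ℕ → ℕ → ℕ → ℕ → List ℕ → ℕ → Bool
  inBox lo hi vlo vhi σ m = (lo <ᵇ m) ∧ (m <ᵇ hi) ∧ (vlo <ᵇ at σ m) ∧ (at σ m <ᵇ vhi)

  boxEmpty : List ℕ → ℕ → ℕ → ℕ → ℕ → Bool
  boxEmpty σ lo hi vlo vhi = not (any (inBox lo hi vlo vhi σ) (range (length σ)))

  BoxEmpty : List ℕ → ℕ → ℕ → ℕ → ℕ → Set
  BoxEmpty σ lo hi vlo vhi =
    ∀ k → k < length σ → lo < suc k → suc k < hi → vlo < at₀ σ k → at₀ σ k < vhi → ⊥

  inBox-true : ∀ {lo hi vlo vhi σ m} → lo < m → m < hi → vlo < at σ m → at σ m < vhi → inBox lo hi vlo vhi σ m ≡ true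
  inBox-true lo<m m<hi vlo<σm σm<vhi rewrite <⇒<ᵇ lo<m | <⇒<ᵇ m<hi | <⇒<ᵇ vlo<σm | <⇒<ᵇ σm<vhi = refl

  inBox-false : ∀ {lo hi vlo vhi σ m} → (lo < m → m < hi → vlo < at σ m → at σ m < vhi → ⊥) →
                inBox lo hi vlo vhi σ m ≡ false
  inBox-false {lo} {hi} {vlo} {vhi} {σ} {m} notIn
    with lo <ᵇ m in e₁ | m <ᵇ hi in e₂ | vlo <ᵇ at σ m in e₃ | at σ m <ᵇ vhi in e₄
  ... | false | _     | _     | _     = refl
  ... | true  | false | _     | _     = refl
  ... | true  | true  | false | _     = refl
  ... | true  | true  | true  | false = refl
  ... | true  | true  | true  | true  = contradiction (<ᵇ⇒< e₄) (notIn (<ᵇ⇒< e₁) (<ᵇ⇒< e₂) (<ᵇ⇒< e₃))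

  boxEmpty⇒BoxEmpty : ∀ σ lo hi vlo vhi → boxEmpty σ lo hi vlo vhi ≡ true → BoxEmpty σ lo hi vlo vhi
  boxEmpty⇒BoxEmpty σ lo hi vlo vhi empty k k<n lo<k k<hi vlo<σk σk<vhi = contradiction
    (trans (sym (inBox-true {lo} {hi} {vlo} {vhi} {σ} lo<k k<hi vlo<σk σk<vhi))
           (any-false⁻ (inBox lo hi vlo vhi σ) (range (length σ)) (not-true⁻ empty) (∈-range⁺ (s≤s z≤n , k<n))))
    λ ()

  BoxEmpty⇒boxEmpty : ∀ σ lo hi vlo vhi → BoxEmpty σ lo hi vlo vhi → boxEmpty σ lo hi vlo vhi ≡ true
  BoxEmpty⇒boxEmpty σ lo hi vlo vhi empty = not-true⁺ (any-false⁺ (inBox lo hi vlo vhi σ) (range (length σ)) outside)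
    where
    outside : ∀ {m} → m ∈ range (length σ) → inBox lo hi vlo vhi σ m ≡ false
    outside {zero}  m∈ = contradiction (proj₁ (∈-range⁻ m∈)) λ ()
    outside {suc k} m∈ = inBox-false {lo} {hi} {vlo} {vhi} {σ} (empty k (proj₂ (∈-range⁻ m∈)))

  record IsOccurrence (σ : List ℕ) (p q : ℕ) : Set where
    field
      p<q     : p < q
      q<n     : q < length σ
      σp<σq   : at₀ σ p < at₀ σ q
      before  : ∀ k → k < p → at₀ σ q < at₀ σ k
      between : ∀ k → p < k → k < q → at₀ σ k < at₀ σ p
      after   : ∀ k → q < k → k < length σ → at₀ σ p < at₀ σ k × at₀ σ k < at₀ σ q

  private module _ {a b x : ℕ} (x≢a : x ≢ a) (x≢b : x ≢ b) where

    above : ¬ x < a → ¬ (a < x × x < b) → b < x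
    above x≮a ¬a<x<b = ℕ.≤∧≢⇒< (ℕ.≮⇒≥ (λ x<b → ¬a<x<b (a<x , x<b))) (≢-sym x≢b)
      where a<x = ℕ.≤∧≢⇒< (ℕ.≮⇒≥ x≮a) (≢-sym x≢a)

    below : ¬ (a < x × x < b) → ¬ b < x → x < a
    below ¬a<x<b b≮x = ℕ.≤∧≢⇒< (ℕ.≮⇒≥ (λ a<x → ¬a<x<b (a<x , x<b))) x≢a
      where x<b = ℕ.≤∧≢⇒< (ℕ.≮⇒≥ b≮x) x≢b

    inside : ¬ x < a → ¬ b < x → a < x × x < b
    inside x≮a b≮x = ℕ.≤∧≢⇒< (ℕ.≮⇒≥ x≮a) (≢-sym x≢a) , ℕ.≤∧≢⇒< (ℕ.≮⇒≥ b≮x) x≢b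

  occurs-Rp⁻ : ∀ σ i j → occurs Rp σ i j ≡ true → let n = length σ ; a = at σ i ; b = at σ j in
    i < j × a < b × BoxEmpty σ 0 i 0 a × BoxEmpty σ 0 i a b × BoxEmpty σ i j a b × BoxEmpty σ i j b (suc n) ×
    BoxEmpty σ j (suc n) 0 a × BoxEmpty σ j (suc n) b (suc n)
  occurs-Rp⁻ σ i j occ
    with i<j   , occ₁ ← ∧-split (i <ᵇ j) occ
    with a<b   , occ₂ ← ∧-split (at σ i <ᵇ at σ j) occ₁
    with e₀₀   , occ₃ ← ∧-split (boxEmpty σ 0 i 0 (at σ i)) occ₂
    with e₀₁   , occ₄ ← ∧-split (boxEmpty σ 0 i (at σ i) (at σ j)) occ₃
    with e₁₁   , occ₅ ← ∧-split (boxEmpty σ i j (at σ i) (at σ j)) occ₄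
    with e₁₂   , occ₆ ← ∧-split (boxEmpty σ i j (at σ j) (suc (length σ))) occ₅
    with e₂₀   , occ₇ ← ∧-split (boxEmpty σ j (suc (length σ)) 0 (at σ i)) occ₆
    with e₂₂   , _    ← ∧-split (boxEmpty σ j (suc (length σ)) (at σ j) (suc (length σ))) occ₇
    = <ᵇ⇒< i<j , <ᵇ⇒< a<b , empty e₀₀ , empty e₀₁ , empty e₁₁ , empty e₁₂ , empty e₂₀ , empty e₂₂
    where
    empty : ∀ {lo hi vlo vhi} → boxEmpty σ lo hi vlo vhi ≡ true → BoxEmpty σ lo hi vlo vhi
    empty = boxEmpty⇒BoxEmpty σ _ _ _ _

  occurs⇒IsOccurrence : ∀ {σ p q} → IsPerm (length σ) σ → p < length σ → q < length σ →
                        occurs Rp σ (suc p) (suc q) ≡ true → IsOccurrence σ p q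
  occurs⇒IsOccurrence {σ} {p} {q} (isPerm _ u in-σ) p<n q<n occ
    with s≤s p<q , σp<σq , box₀₀ , box₀₁ , box₁₁ , box₁₂ , box₂₀ , box₂₂ ← occurs-Rp⁻ σ (suc p) (suc q) occ
    = record { p<q = p<q ; q<n = q<n ; σp<σq = σp<σq ; before = before ; between = between ; after = after }
    where
    n = length σ
    a = at₀ σ p
    b = at₀ σ q
    σk≥1 : ∀ {k} → k < n → 0 < at₀ σ k
    σk≥1 k<n = proj₁ (All.lookup in-σ (at₀-∈ σ k<n))
    σk≤n : ∀ {k} → k < n → at₀ σ k < suc n
    σk≤n k<n = s≤s (proj₂ (All.lookup in-σ (at₀-∈ σ k<n)))
    injective : ∀ {k k′} → k < n → k′ < n → k ≢ k′ → at₀ σ k ≢ at₀ σ k′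
    injective k<n k′<n k≢k′ = k≢k′ ∘ at₀-injective u k<n k′<n
    before : ∀ k → k < p → b < at₀ σ k
    before k k<p = above (injective k<n p<n (ℕ.<⇒≢ k<p)) (injective k<n q<n (ℕ.<⇒≢ (ℕ.<-trans k<p p<q)))
      (box₀₀ k k<n (s≤s z≤n) (s≤s k<p) (σk≥1 k<n))
      (λ (a<σk , σk<b) → box₀₁ k k<n (s≤s z≤n) (s≤s k<p) a<σk σk<b)
      where k<n = ℕ.<-trans k<p p<n
    between : ∀ k → p < k → k < q → at₀ σ k < a
    between k p<k k<q = below (injective k<n p<n (≢-sym (ℕ.<⇒≢ p<k))) (injective k<n q<n (ℕ.<⇒≢ k<q))
      (λ (a<σk , σk<b) → box₁₁ k k<n (s≤s p<k) (s≤s k<q) a<σk σk<b)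
      (λ b<σk → box₁₂ k k<n (s≤s p<k) (s≤s k<q) b<σk (σk≤n k<n))
      where k<n = ℕ.<-trans k<q q<n
    after : ∀ k → q < k → k < n → a < at₀ σ k × at₀ σ k < b
    after k q<k k<n =
      inside (injective k<n p<n (≢-sym (ℕ.<⇒≢ (ℕ.<-trans p<q q<k)))) (injective k<n q<n (≢-sym (ℕ.<⇒≢ q<k)))
      (box₂₀ k k<n (s≤s q<k) (s≤s k<n) (σk≥1 k<n))
      (λ b<σk → box₂₂ k k<n (s≤s q<k) (s≤s k<n) b<σk (σk≤n k<n))

  IsOccurrence⇒occurs : ∀ {σ p q} → IsOccurrence σ p q → occurs Rp σ (suc p) (suc q) ≡ true
  IsOccurrence⇒occurs {σ} {p} {q} occ =
    ∧-intro (<⇒<ᵇ (s≤s p<q)) (∧-intro (<⇒<ᵇ σp<σq)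
    (∧-intro (empty 0 (suc p) 0 a
       λ k _ _ k<p _ σk<a → ℕ.<-asym (ℕ.<-trans σp<σq (before k (ℕ.≤-pred k<p))) σk<a)
    (∧-intro (empty 0 (suc p) a b
       λ k _ _ k<p _ σk<b → ℕ.<-asym (before k (ℕ.≤-pred k<p)) σk<b)
    (∧-intro (empty (suc p) (suc q) a b
       λ k _ p<k k<q a<σk _ → ℕ.<-asym (between k (ℕ.≤-pred p<k) (ℕ.≤-pred k<q)) a<σk)
    (∧-intro (empty (suc p) (suc q) b (suc n)
       λ k _ p<k k<q b<σk _ → ℕ.<-asym (ℕ.<-trans (between k (ℕ.≤-pred p<k) (ℕ.≤-pred k<q)) σp<σq) b<σk)
    (∧-intro (empty (suc q) (suc n) 0 a
       λ k k<n q<k _ _ σk<a → ℕ.<-asym (proj₁ (after k (ℕ.≤-pred q<k) k<n)) σk<a)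
    (∧-intro (empty (suc q) (suc n) b (suc n)
       λ k k<n q<k _ b<σk _ → ℕ.<-asym (proj₂ (after k (ℕ.≤-pred q<k) k<n)) b<σk)
    refl)))))))
    where
    open IsOccurrence occ
    n = length σ
    a = at₀ σ p
    b = at₀ σ q
    empty = BoxEmpty⇒boxEmpty σ

  private
    occurrence-start-unique : ∀ {σ p q p′ q′} → IsOccurrence σ p q → IsOccurrence σ p′ q′ → ¬ p < p′
    occurrence-start-unique {σ} {p} {q} {p′} {q′} V W p<p′ = compare (ℕ.<-cmp p′ q)
      where
      module V = IsOccurrence V
      module W = IsOccurrence W
      case : p′ < q → Tri (q′ < q) (q′ ≡ q) (q < q′) → ⊥
      case _    (tri< q′<q _ _) = ℕ.<-irrefl refl (ℕ.<-trans (proj₂ (W.after q q′<q V.q<n))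
                                (ℕ.<-trans (V.between q′ (ℕ.<-trans p<p′ W.p<q) q′<q) V.σp<σq))
      case _    (tri≈ _ refl _) = ℕ.<-asym V.σp<σq (W.before p p<p′)
      case p′<q (tri> _ _ q<q′) = ℕ.<-irrefl refl (ℕ.<-trans (W.between q p′<q q<q′)
                                (ℕ.<-trans (V.between p′ p<p′ p′<q) V.σp<σq))
      compare : Tri (p′ < q) (p′ ≡ q) (q < p′) → ⊥
      compare (tri< p′<q _ _) = case p′<q (ℕ.<-cmp q′ q)
      compare (tri≈ _ refl _) = ℕ.<-asym W.σp<σq (proj₂ (V.after q′ W.p<q W.q<n))
      compare (tri> _ _ q<p′) = ℕ.<-irrefl refl (ℕ.<-trans (proj₁ (V.after p′ q<p′ (ℕ.<-trans W.p<q W.q<n)))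
                                                  (ℕ.<-trans W.σp<σq (W.before p p<p′)))

    occurrence-end-unique : ∀ {σ p q q′} → IsOccurrence σ p q → IsOccurrence σ p q′ → ¬ q < q′
    occurrence-end-unique V W q<q′ = ℕ.<-asym (IsOccurrence.σp<σq V) (IsOccurrence.between W _ (IsOccurrence.p<q V) q<q′)

  IsOccurrence-unique : ∀ {σ p q p′ q′} → IsOccurrence σ p q → IsOccurrence σ p′ q′ → p ≡ p′ × q ≡ q′
  IsOccurrence-unique {p = p} {q} {p′} {q′} V W with ℕ.<-cmp p p′
  ... | tri< p<p′ _ _ = contradiction p<p′ (occurrence-start-unique V W)
  ... | tri> _ _ p′<p = contradiction p′<p (occurrence-start-unique W V)
  ... | tri≈ _ refl _ with ℕ.<-cmp q q′
  ...   | tri< q<q′ _ _ = contradiction q<q′ (occurrence-end-unique V W)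
  ...   | tri≈ _ q≡q′ _ = refl , q≡q′
  ...   | tri> _ _ q′<q = contradiction q′<q (occurrence-end-unique W V)

  positionPairs : ℕ → List (ℕ × ℕ)
  positionPairs n = concatMap (λ a → map (λ b → a , b) (range n)) (range n)

  private
    positionPairs≡ : ∀ n → positionPairs n ≡ cartesianProduct (range n) (range n)
    positionPairs≡ n = concatMap-map _,_ (range n) (range n)

    ∈-positionPairs⁺ : ∀ {n p q} → p < n → q < n → (suc p , suc q) ∈ positionPairs n
    ∈-positionPairs⁺ {n} p<n q<n =
      subst (_ ∈_) (sym (positionPairs≡ n)) (∈-cartesianProduct⁺ (∈-range⁺ (s≤s z≤n , p<n)) (∈-range⁺ (s≤s z≤n , q<n)))

    ∈-positionPairs⁻ : ∀ n {i j} → (i , j) ∈ positionPairs n → ∃₂ λ p q → i ≡ suc p × j ≡ suc q × p < n × q < n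
    ∈-positionPairs⁻ n {i} {j} ij∈
      with i∈ , j∈ ← ∈-cartesianProduct⁻ (range n) (range n) (subst (_ ∈_) (positionPairs≡ n) ij∈)
      = position i∈ (∈-range⁻ i∈) j∈ (∈-range⁻ j∈)
      where
      position : ∀ {i j} → i ∈ range n → InRange n i → j ∈ range n → InRange n j →
                 ∃₂ λ p q → i ≡ suc p × j ≡ suc q × p < n × q < n
      position {suc p} {suc q} _ (_ , p<n) _ (_ , q<n) = p , q , refl , refl , p<n , q<n

  patCount≤1 : ∀ {σ} → IsPerm (length σ) σ → patCount Rp σ ≤ 1
  patCount≤1 {σ} perm = filter-length≤1 _ Unique-pairs same
    where
    n = length σ
    Unique-pairs : Unique (positionPairs n)
    Unique-pairs = subst Unique (sym (positionPairs≡ n)) (Unique.cartesianProduct⁺ (Unique-range n) (Unique-range n))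
    same : ∀ {x y} → x ∈ positionPairs n → y ∈ positionPairs n →
           occurs Rp σ (proj₁ x) (proj₂ x) ≡ true → occurs Rp σ (proj₁ y) (proj₂ y) ≡ true → x ≡ y
    same {i , j} {i′ , j′} x∈ y∈ occ occ′
      with p , q , refl , refl , p<n , q<n ← ∈-positionPairs⁻ n x∈
      with p′ , q′ , refl , refl , p′<n , q′<n ← ∈-positionPairs⁻ n y∈
      with refl , refl ← IsOccurrence-unique (occurs⇒IsOccurrence perm p<n q<n occ)
                                             (occurs⇒IsOccurrence perm p′<n q′<n occ′)
      = refl

  patCount≡1 : ∀ {σ p q} → IsPerm (length σ) σ → IsOccurrence σ p q → patCount Rp σ ≡ 1
  patCount≡1 perm occ = ℕ.≤-antisym (patCount≤1 perm)
    (List.filter-some _ (lose (∈-positionPairs⁺ (ℕ.<-trans p<q q<n) q<n) (IsOccurrence⇒occurs occ)))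
    where open IsOccurrence occ

  patCount≡1⇒IsOccurrence : ∀ {σ} → IsPerm (length σ) σ → patCount Rp σ ≡ 1 → ∃₂ (IsOccurrence σ)
  patCount≡1⇒IsOccurrence {σ} perm count≡1
    with (i , j) , ij∈ , occ ← filter-nonempty _ (positionPairs (length σ)) count≡1
    with p , q , refl , refl , p<n , q<n ← ∈-positionPairs⁻ (length σ) ij∈
    = p , q , occurs⇒IsOccurrence perm p<n q<n occ

  blocks : List ℕ → ℕ → List ℕ → ℕ → List ℕ → List ℕ
  blocks P a M b R = P ++ a ∷ (M ++ b ∷ R)

  record OccurrenceBlocks (P : List ℕ) (a : ℕ) (M : List ℕ) (b : ℕ) (R : List ℕ) : Set where
    field
      a<b       : a < b
      P-above   : All (b <_) P
      M-below   : All (_< a) M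
      R-between : All (λ x → a < x × x < b) R

  position-b : List ℕ → List ℕ → ℕ
  position-b P M = length P + suc (length M)

  length-blocks : ∀ P a M b R → length (blocks P a M b R) ≡ position-b P M + suc (length R)
  length-blocks P a M b R = begin
    length (P ++ a ∷ (M ++ b ∷ R))             ≡⟨ List.length-++ P ⟩
    length P + suc (length (M ++ b ∷ R))       ≡⟨ cong (λ m → length P + suc m) (List.length-++ M) ⟩
    length P + (suc (length M) + suc (length R)) ≡⟨ ℕ.+-assoc (length P) (suc (length M)) (suc (length R)) ⟨
    position-b P M + suc (length R)                ∎
    where open ≡-Reasoning

  module _ (P : List ℕ) (a : ℕ) (M : List ℕ) (b : ℕ) (R : List ℕ) where

    private
      σ = blocks P a M b R
      T = M ++ b ∷ R

    at₀-P : ∀ {k} → k < length P → at₀ σ k ≡ at₀ P k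
    at₀-P = at₀-++ˡ P (a ∷ T)

    at₀-a : at₀ σ (length P) ≡ a
    at₀-a = trans (cong (at₀ σ) (sym (ℕ.+-identityʳ (length P)))) (at₀-++ʳ P (a ∷ T) 0)

    at₀-M : ∀ {j} → j < length M → at₀ σ (length P + suc j) ≡ at₀ M j
    at₀-M j<m = trans (at₀-++ʳ P (a ∷ T) (suc _)) (at₀-++ˡ M (b ∷ R) j<m)

    at₀-b : at₀ σ (position-b P M) ≡ b
    at₀-b = trans (at₀-++ʳ P (a ∷ T) (suc (length M))) (trans (cong (at₀ T) (sym (ℕ.+-identityʳ (length M)))) (at₀-++ʳ M (b ∷ R) 0))

    at₀-R : ∀ i → at₀ σ (length P + suc (length M + suc i)) ≡ at₀ R i
    at₀-R i = trans (at₀-++ʳ P (a ∷ T) (suc (length M + suc i))) (at₀-++ʳ M (b ∷ R) (suc i))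

    private
      +-suc-assoc : ∀ i → suc (position-b P M + i) ≡ length P + suc (length M + suc i)
      +-suc-assoc i = begin
        suc (position-b P M + i)                 ≡⟨ ℕ.+-suc (position-b P M) i ⟨
        length P + suc (length M) + suc i    ≡⟨ ℕ.+-assoc (length P) (suc (length M)) (suc i) ⟩
        length P + suc (length M + suc i)    ∎
        where open ≡-Reasoning

    OccurrenceBlocks⇒IsOccurrence : OccurrenceBlocks P a M b R → IsOccurrence σ (length P) (position-b P M)
    OccurrenceBlocks⇒IsOccurrence blk = record
      { p<q = p<q ; q<n = q<n ; σp<σq = subst₂ _<_ (sym at₀-a) (sym at₀-b) a<b
      ; before = before ; between = between ; after = after }
      where
      open OccurrenceBlocks blk
      p<q : length P < position-b P M
      p<q = ℕ.m<m+n (length P) (s≤s z≤n)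
      q<n : position-b P M < length σ
      q<n = subst (position-b P M <_) (sym (length-blocks P a M b R)) (ℕ.m<m+n (position-b P M) (s≤s z≤n))
      before : ∀ k → k < length P → at₀ σ (position-b P M) < at₀ σ k
      before k k<p = subst₂ _<_ (sym at₀-b) (sym (at₀-P k<p)) (All.lookup P-above (at₀-∈ P k<p))
      between : ∀ k → length P < k → k < position-b P M → at₀ σ k < at₀ σ (length P)
      between k p<k k<q with j , refl ← ℕ.m≤n⇒∃[o]m+o≡n p<k = subst₂ _<_ (sym σk≡) (sym at₀-a) (All.lookup M-below (at₀-∈ M j<m))
        where
        k≡ : suc (length P) + j ≡ length P + suc j
        k≡ = sym (ℕ.+-suc (length P) j)
        j<m : j < length M
        j<m = ℕ.≤-pred (ℕ.+-cancelˡ-< (length P) (suc j) (suc (length M)) (subst (_< position-b P M) k≡ k<q))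
        σk≡ : at₀ σ (suc (length P) + j) ≡ at₀ M j
        σk≡ = trans (cong (at₀ σ) k≡) (at₀-M j<m)
      after : ∀ k → position-b P M < k → k < length σ → at₀ σ (length P) < at₀ σ k × at₀ σ k < at₀ σ (position-b P M)
      after k q<k k<n with i , refl ← ℕ.m≤n⇒∃[o]m+o≡n q<k =
        subst₂ _<_ (sym at₀-a) (sym σk≡) (proj₁ a<σk<b) , subst₂ _<_ (sym σk≡) (sym at₀-b) (proj₂ a<σk<b)
        where
        i<r : i < length R
        i<r = ℕ.+-cancelˡ-< (suc (position-b P M)) i (length R)
                (subst (suc (position-b P M) + i <_) (trans (length-blocks P a M b R) (ℕ.+-suc (position-b P M) (length R))) k<n)
        σk≡ : at₀ σ (suc (position-b P M) + i) ≡ at₀ R i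
        σk≡ = trans (cong (at₀ σ) (+-suc-assoc i)) (at₀-R i)
        a<σk<b : a < at₀ R i × at₀ R i < b
        a<σk<b = All.lookup R-between (at₀-∈ R i<r)

    IsOccurrence⇒OccurrenceBlocks : IsOccurrence σ (length P) (position-b P M) → OccurrenceBlocks P a M b R
    IsOccurrence⇒OccurrenceBlocks occ = record
      { a<b = subst₂ _<_ at₀-a at₀-b σp<σq
      ; P-above = All.tabulate P-above ; M-below = All.tabulate M-below ; R-between = All.tabulate R-between }
      where
      open IsOccurrence occ
      P-above : ∀ {x} → x ∈ P → b < x
      P-above x∈ with k , k<p , refl ← ∈⇒at₀ P x∈ = subst₂ _<_ at₀-b (at₀-P k<p) (before k k<p)
      M-below : ∀ {x} → x ∈ M → x < a
      M-below x∈ with j , j<m , refl ← ∈⇒at₀ M x∈ =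
        subst₂ _<_ (at₀-M j<m) at₀-a (between _ (ℕ.m<m+n (length P) (s≤s z≤n)) (ℕ.+-monoʳ-< (length P) (s≤s j<m)))
      R-between : ∀ {x} → x ∈ R → a < x × x < b
      R-between x∈ with i , i<r , refl ← ∈⇒at₀ R x∈ =
        subst₂ _<_ at₀-a (at₀-R i) (proj₁ a<σk<b) , subst₂ _<_ (at₀-R i) at₀-b (proj₂ a<σk<b)
        where
        k = length P + suc (length M + suc i)
        q<k : position-b P M < k
        q<k = subst (position-b P M <_) (+-suc-assoc i) (s≤s (ℕ.m≤m+n _ i))
        k<n : k < length σ
        k<n = subst (k <_) (sym (length-blocks P a M b R))
                (subst₂ _<_ (+-suc-assoc i) (sym (ℕ.+-suc (position-b P M) (length R)))
                  (s≤s (ℕ.+-monoʳ-< (position-b P M) i<r)))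
        a<σk<b : at₀ σ (length P) < at₀ σ k × at₀ σ k < at₀ σ (position-b P M)
        a<σk<b = after k q<k k<n

  private
    split-at : ∀ (xs : List ℕ) k → k < length xs → ∃₂ λ P x → ∃ λ S → xs ≡ P ++ x ∷ S × length P ≡ k
    split-at (x ∷ xs) zero    _         = [] , x , xs , refl , refl
    split-at (x ∷ xs) (suc k) (s≤s k<n) with P , y , S , refl , refl ← split-at xs k k<n = x ∷ P , y , S , refl , refl

    index-in-suffix : ∀ (P : List ℕ) a S {j} → suc (length P) + j < length (P ++ a ∷ S) → j < length S
    index-in-suffix P a S {j} k<n = ℕ.+-cancelˡ-< (suc (length P)) j (length S)
      (subst (suc (length P) + j <_) (trans (List.length-++ P) (ℕ.+-suc (length P) (length S))) k<n)

  split-blocks : ∀ σ {p q} → p < q → q < length σ →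
                 ∃₂ λ P a → ∃₂ λ M b → ∃ λ R → σ ≡ blocks P a M b R × length P ≡ p × position-b P M ≡ q
  split-blocks σ {p} {q} p<q q<n
    with P , a , S , refl , refl ← split-at σ p (ℕ.<-trans p<q q<n)
    with j , refl ← ℕ.m≤n⇒∃[o]m+o≡n p<q
    with M , b , R , refl , refl ← split-at S j (index-in-suffix P a S q<n)
    = P , a , M , b , R , refl , refl , ℕ.+-suc (length P) (length M)

  farApart-< : ∀ {x y} → suc x < y → farApart x y ≡ true
  farApart-< x+1<y rewrite <⇒<ᵇ x+1<y = refl

  farApart-> : ∀ {x y} → suc y < x → farApart x y ≡ true
  farApart-> {x} {y} y+1<x rewrite <⇒<ᵇ y+1<x = Bool.∨-zeroʳ (suc x <ᵇ y)

  farApart-suc : ∀ a → farApart a (suc a) ≡ false × farApart (suc a) a ≡ false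
  farApart-suc zero    = refl , refl
  farApart-suc (suc a) = farApart-suc a

  farApart-+ : ∀ c x y → farApart (c + x) (c + y) ≡ farApart x y
  farApart-+ zero    x y = refl
  farApart-+ (suc c) x y = farApart-+ c x y

  isKing-+ : ∀ c xs → isKing (map (c +_) xs) ≡ isKing xs
  isKing-+ c []           = refl
  isKing-+ c (x ∷ [])     = refl
  isKing-+ c (x ∷ y ∷ xs) = cong₂ _∧_ (farApart-+ c x y) (isKing-+ c (y ∷ xs))

  isKing-tail : ∀ x xs → isKing (x ∷ xs) ≡ true → isKing xs ≡ true
  isKing-tail x []       _    = refl
  isKing-tail x (y ∷ xs) king = proj₂ (∧-split (farApart x y) king)

  joinsFar : List ℕ → List ℕ → Bool
  joinsFar []           _        = true
  joinsFar (x ∷ [])     []       = true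
  joinsFar (x ∷ [])     (y ∷ ys) = farApart x y
  joinsFar (x ∷ x′ ∷ xs) ys      = joinsFar (x′ ∷ xs) ys

  joinsFar-all : ∀ xs y ys → All (λ x → farApart x y ≡ true) xs → joinsFar xs (y ∷ ys) ≡ true
  joinsFar-all []            y ys []                = refl
  joinsFar-all (x ∷ [])      y ys (far ∷ [])        = far
  joinsFar-all (x ∷ x′ ∷ xs) y ys (_ ∷ far)         = joinsFar-all (x′ ∷ xs) y ys far

  isKing-++⁺ : ∀ xs ys → isKing xs ≡ true → isKing ys ≡ true → joinsFar xs ys ≡ true → isKing (xs ++ ys) ≡ true
  isKing-++⁺ []            ys _     ys-king _    = ys-king
  isKing-++⁺ (x ∷ [])      []       _ _ _        = refl
  isKing-++⁺ (x ∷ [])      (y ∷ ys) _ ys-king far = ∧-intro far ys-king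
  isKing-++⁺ (x ∷ x′ ∷ xs) ys xs-king ys-king far =
    let x-far , xs-king′ = ∧-split (farApart x x′) xs-king in
    ∧-intro x-far (isKing-++⁺ (x′ ∷ xs) ys xs-king′ ys-king far)

  isKing-++⁻ : ∀ xs ys → isKing (xs ++ ys) ≡ true → isKing xs ≡ true × isKing ys ≡ true
  isKing-++⁻ []            ys king = refl , king
  isKing-++⁻ (x ∷ [])      ys king = refl , isKing-tail x ys king
  isKing-++⁻ (x ∷ x′ ∷ xs) ys king =
    let x-far , king′ = ∧-split (farApart x x′) king
        xs-king , ys-king = isKing-++⁻ (x′ ∷ xs) ys king′
    in ∧-intro x-far xs-king , ys-king

  startsWith : ℕ → List ℕ → Bool
  startsWith m []      = false
  startsWith m (x ∷ _) = x ≡ᵇ m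

  KnTop : ℕ → List (List ℕ)
  KnTop m = filter (λ σ → startsWith m σ Bool.≟ true) (Kn m)

  ∈-KnTop⁺ : ∀ {m x τ} → IsPerm m (x ∷ τ) → isKing (x ∷ τ) ≡ true → x ≡ m → x ∷ τ ∈ KnTop m
  ∈-KnTop⁺ {m} perm king x≡m = ∈-filter⁺ (λ σ → startsWith m σ Bool.≟ true) (∈-Kn⁺ perm king) (≡⇒≡ᵇ x≡m)

  ∈-KnTop⁻ : ∀ {m σ} → σ ∈ KnTop m → ∃ λ τ → σ ≡ m ∷ τ × IsPerm m σ × isKing σ ≡ true
  ∈-KnTop⁻ {m} {σ} σ∈ with σ∈Kn , starts ← ∈-filter⁻ (λ σ → startsWith m σ Bool.≟ true) {xs = Kn m} σ∈
                      with perm , king ← ∈-Kn⁻ {m} σ∈Kn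
                      with x ∷ τ ← σ
                      with refl ← ≡ᵇ⇒≡ {x} {m} starts = τ , refl , perm , king

  Unique-KnTop : ∀ m → Unique (KnTop m)
  Unique-KnTop m = Unique.filter⁺ (λ σ → startsWith m σ Bool.≟ true) (Unique-Kn m)

  length-KnTop-suc≡length-filter : ∀ n →
    length (KnTop (suc n)) ≡ length (filter (λ τ → not (startsWith n τ) Bool.≟ true) (Kn n))
  length-KnTop-suc≡length-filter n =
    trans (Unique-⊆⊇⇒length≡ (Unique-KnTop (suc n))
                             (Unique.map⁺ List.∷-injectiveʳ (Unique.filter⁺ notStart? (Unique-Kn n))) KnTop⊆ ⊆KnTop)
          (List.length-map extend (filter notStart? (Kn n)))
    where
    notStart? = λ τ → not (startsWith n τ) Bool.≟ true
    extend : List ℕ → List ℕ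
    extend τ = suc n ∷ τ
    extensions = map extend (filter notStart? (Kn n))
    doesn't-start : ∀ τ → isKing (suc n ∷ τ) ≡ true → not (startsWith n τ) ≡ true
    doesn't-start []      _    = refl
    doesn't-start (y ∷ τ) king with y ≡ᵇ n in y≡ᵇn
    ... | false = refl
    ... | true with refl ← ≡ᵇ⇒≡ {y} {n} y≡ᵇn =
      contradiction (trans (sym (proj₁ (∧-split (farApart (suc y) y) king))) (proj₂ (farApart-suc y))) λ ()
    king-∷ : ∀ τ → All (λ v → 1 ≤ v × v ≤ n) τ → not (startsWith n τ) ≡ true → isKing τ ≡ true →
             isKing (suc n ∷ τ) ≡ true
    king-∷ []      _                  _         _    = refl
    king-∷ (y ∷ τ) ((_ , y≤n) ∷ _) y≢n king = ∧-intro (farApart-> (s≤s (ℕ.≤∧≢⇒< y≤n y≢n′))) king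
      where y≢n′ = λ y≡n → contradiction (trans (sym (≡⇒≡ᵇ y≡n)) (not-true⁻ y≢n)) λ ()
    KnTop⊆ : ∀ {σ} → σ ∈ KnTop (suc n) → σ ∈ extensions
    KnTop⊆ σ∈ with τ , refl , perm , king ← ∈-KnTop⁻ {suc n} σ∈ =
      ∈-map⁺ extend (∈-filter⁺ notStart? (∈-Kn⁺ (IsPerm-∷⁻ perm) (isKing-tail (suc n) τ king)) (doesn't-start τ king))
    ⊆KnTop : ∀ {σ} → σ ∈ extensions → σ ∈ KnTop (suc n)
    ⊆KnTop σ∈ with τ , τ∈ , refl ← ∈-map⁻ extend σ∈
              with τ∈Kn , no-start ← ∈-filter⁻ notStart? {xs = Kn n} τ∈
              with perm , king ← ∈-Kn⁻ {n} τ∈Kn =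
      ∈-KnTop⁺ (IsPerm-∷⁺ perm) (king-∷ τ (IsPerm.inRange perm) no-start king) refl

  length-KnTop-suc : ∀ n → length (KnTop (suc n)) + length (KnTop n) ≡ length (Kn n)
  length-KnTop-suc n = begin
    length (KnTop (suc n)) + length (KnTop n)
      ≡⟨ cong (_+ length (KnTop n)) (length-KnTop-suc≡length-filter n) ⟩
    length (filter (λ τ → not (startsWith n τ) Bool.≟ true) (Kn n)) + length (KnTop n)
      ≡⟨ ℕ.+-comm _ (length (KnTop n)) ⟩
    length (KnTop n) + length (filter (λ τ → not (startsWith n τ) Bool.≟ true) (Kn n))
      ≡⟨ length-filter-complement (startsWith n) (not ∘ startsWith n) (Kn n) (λ _ → refl) ⟩
    length (Kn n) ∎
    where open ≡-Reasoning

  directSum : List ℕ → List ℕ → List ℕ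
  directSum xs ys = xs ++ map (length xs +_) ys

  skewSum : List ℕ → List ℕ → List ℕ
  skewSum xs ys = map (length ys +_) xs ++ ys

  length-directSum : ∀ xs ys → length (directSum xs ys) ≡ length xs + length ys
  length-directSum xs ys = trans (List.length-++ xs) (cong (length xs +_) (List.length-map _ ys))

  length-skewSum : ∀ xs ys → length (skewSum xs ys) ≡ length xs + length ys
  length-skewSum xs ys = trans (List.length-++ (map _ xs)) (cong (_+ length ys) (List.length-map _ xs))

  private
    shift-bounds : ∀ a {b ys} → All (InRange b) ys → All (λ v → a < v × v ≤ a + b) (map (a +_) ys)
    shift-bounds a in-ys = All.map⁺ (All.map (λ (1≤v , v≤b) → ℕ.m<m+n a 1≤v , ℕ.+-monoʳ-≤ a v≤b) in-ys)

    Unique-shift : ∀ a {ys} → Unique ys → Unique (map (a +_) ys)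
    Unique-shift a = Unique.map⁺ (ℕ.+-cancelˡ-≡ a _ _)

    separated : ∀ {c} {xs ys : List ℕ} → All (_≤ c) xs → All (c <_) ys → ∀ {v} → ¬ (v ∈ xs × v ∈ ys)
    separated xs≤c c<ys (v∈xs , v∈ys) = ℕ.<-irrefl refl (ℕ.≤-<-trans (All.lookup xs≤c v∈xs) (All.lookup c<ys v∈ys))

  IsPerm-directSum : ∀ {a b xs ys} → IsPerm a xs → IsPerm b ys → IsPerm (a + b) (directSum xs ys)
  IsPerm-directSum {a} {b} {xs} {ys} (isPerm refl u-xs in-xs) (isPerm refl u-ys in-ys) = isPerm
    (length-directSum xs ys)
    (Unique.++⁺ u-xs (Unique-shift a u-ys) (separated (All.map proj₂ in-xs) (All.map proj₁ shifted)))
    (All.++⁺ (All.map (λ (1≤v , v≤a) → 1≤v , ℕ.m≤n⇒m≤n+o b v≤a) in-xs)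
             (All.map (λ (a<v , v≤a+b) → ℕ.≤-trans (s≤s z≤n) a<v , v≤a+b) shifted))
    where shifted = shift-bounds a in-ys

  IsPerm-skewSum : ∀ {a b xs ys} → IsPerm a xs → IsPerm b ys → IsPerm (a + b) (skewSum xs ys)
  IsPerm-skewSum {a} {b} {xs} {ys} (isPerm refl u-xs in-xs) (isPerm refl u-ys in-ys) = isPerm
    (length-skewSum xs ys)
    (Unique.++⁺ (Unique-shift b u-xs) u-ys λ (v∈xs , v∈ys) →
      separated (All.map proj₂ in-ys) (All.map proj₁ shifted) (v∈ys , v∈xs))
    (All.++⁺ (All.map (λ {v} (b<v , v≤b+a) → ℕ.≤-trans (s≤s z≤n) b<v , subst (v ≤_) (ℕ.+-comm b a) v≤b+a) shifted)
             (All.map (λ (1≤v , v≤b) → 1≤v , ℕ.m≤n⇒m≤o+n a v≤b) in-ys))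
    where shifted = shift-bounds b in-xs

  glue : List ℕ → List ℕ → List ℕ → List ℕ
  glue L X Y = skewSum L (directSum X Y)

  length-glue : ∀ L X Y → length (glue L X Y) ≡ length L + (length X + length Y)
  length-glue L X Y = trans (length-skewSum L (directSum X Y)) (cong (length L +_) (length-directSum X Y))

  record Admissible (L X Y : List ℕ) : Set where
    field
      L-king     : L ∈ Kn (length L)
      X-top      : X ∈ KnTop (length X)
      Y-top      : Y ∈ KnTop (length Y)
      not-both-1 : ¬ (length X ≡ 1 × length Y ≡ 1)

  module _ (L X′ Y′ : List ℕ) where

    private
      m = suc (length X′)
      r = suc (length Y′)
      k = length (directSum (m ∷ X′) (r ∷ Y′))

    glue-OccurrenceBlocks : All (1 ≤_) L → All (_< m) X′ → All (λ v → 1 ≤ v × v < r) Y′ →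
                            OccurrenceBlocks (map (k +_) L) m X′ (m + r) (map (m +_) Y′)
    glue-OccurrenceBlocks L≥1 X′<m Y′-bounds = record
      { a<b       = ℕ.m<m+n m (s≤s z≤n)
      ; P-above   = All.map⁺ (All.map (λ {v} 1≤v →
                      subst (λ c → c < k + v) (length-directSum (m ∷ X′) (r ∷ Y′)) (ℕ.m<m+n k 1≤v)) L≥1)
      ; M-below   = X′<m
      ; R-between = All.map⁺ (All.map (λ (1≤v , v<r) → ℕ.m<m+n m 1≤v , ℕ.+-monoʳ-< m v<r) Y′-bounds) }

    glue-isKing : All (1 ≤_) L → All (_< m) X′ → All (λ v → 1 ≤ v × v < r) Y′ →
                  isKing L ≡ true → isKing (m ∷ X′) ≡ true → isKing (r ∷ Y′) ≡ true →
                  ¬ (m ≡ 1 × r ≡ 1) → isKing (glue L (m ∷ X′) (r ∷ Y′)) ≡ true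
    glue-isKing L≥1 X′<m Y′-bounds L-king X-king Y-king not-both-1 =
      isKing-++⁺ (map (k +_) L) _ (trans (isKing-+ k L) L-king)
        (isKing-++⁺ (m ∷ X′) _ X-king (trans (isKing-+ m (r ∷ Y′)) Y-king) (X-joins-Y X′ X′<m not-both-1))
        (joinsFar-all _ m _ (All.map (λ m+r<v → farApart-> (ℕ.≤-<-trans (ℕ.m<m+n m (s≤s z≤n)) m+r<v)) L′>m+r))
      where
      L′>m+r : All (m + r <_) (map (k +_) L)
      L′>m+r = OccurrenceBlocks.P-above (glue-OccurrenceBlocks L≥1 X′<m Y′-bounds)
      X-joins-Y : ∀ X″ → All (_< suc (length X″)) X″ → ¬ (suc (length X″) ≡ 1 × r ≡ 1) →
                  joinsFar (suc (length X″) ∷ X″) (map (suc (length X″) +_) (r ∷ Y′)) ≡ true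
      X-joins-Y []         _      not-both-1 =
        farApart-< (s≤s (ℕ.≤∧≢⇒< (s≤s z≤n) (λ 1≡r → not-both-1 (refl , sym 1≡r))))
      X-joins-Y (x ∷ X‴) X″<m _ =
        joinsFar-all (x ∷ X‴) _ _ (All.map (λ v<m′ → farApart-< (ℕ.<-≤-trans (s≤s v<m′) (ℕ.m<m+n _ (s≤s z≤n)))) X″<m)

  glue-Kn-occurrence : ∀ {L X Y} → Admissible L X Y →
    glue L X Y ∈ Kn (length L + (length X + length Y)) × IsOccurrence (glue L X Y) (length L) (length L + length X)
  glue-Kn-occurrence {L} {x ∷ X′} {y ∷ Y′} adm
    with _ , refl , X-perm , X-king ← ∈-KnTop⁻ {suc (length X′)} (Admissible.X-top adm)
    with _ , refl , Y-perm , Y-king ← ∈-KnTop⁻ {suc (length Y′)} (Admissible.Y-top adm)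
    with L-perm , L-king ← ∈-Kn⁻ {length L} (Admissible.L-king adm)
    = ∈-Kn⁺ (IsPerm-skewSum L-perm (IsPerm-directSum X-perm Y-perm))
            (glue-isKing L X′ Y′ L≥1 X′<m Y′-bounds L-king X-king Y-king (Admissible.not-both-1 adm))
    , subst (λ p → IsOccurrence (glue L (x ∷ X′) (y ∷ Y′)) p (p + length (x ∷ X′))) (List.length-map _ L)
        (OccurrenceBlocks⇒IsOccurrence _ _ X′ _ _ (glue-OccurrenceBlocks L X′ Y′ L≥1 X′<m Y′-bounds))
    where
    L≥1 : All (1 ≤_) L
    L≥1 = All.map proj₁ (IsPerm.inRange L-perm)
    X′<m : All (_< suc (length X′)) X′
    X′<m = All.map proj₂ (IsPerm-∷-max X-perm)
    Y′-bounds : All (λ v → 1 ≤ v × v < suc (length Y′)) Y′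
    Y′-bounds = IsPerm-∷-max Y-perm
  glue-Kn-occurrence {X = []} adm with () ← ∈-KnTop⁻ {0} (Admissible.X-top adm)
  glue-Kn-occurrence {X = _ ∷ _} {[]} adm with () ← ∈-KnTop⁻ {0} (Admissible.Y-top adm)

  -- The occurrence of the glued permutation sits at positions |L| and |L| + |X|, so its
  -- uniqueness recovers the lengths, and with them the three pieces.
  glue-injective : ∀ {L X Y L′ X′ Y′} → Admissible L X Y → Admissible L′ X′ Y′ →
                   glue L X Y ≡ glue L′ X′ Y′ → L ≡ L′ × X ≡ X′ × Y ≡ Y′
  glue-injective {L} {X} {Y} {L′} {X′} {Y′} adm adm′ glue≡
    with |L|≡ , |L|+|X|≡ ← IsOccurrence-unique (proj₂ (glue-Kn-occurrence adm))
           (subst (λ σ → IsOccurrence σ (length L′) (length L′ + length X′)) (sym glue≡)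
                  (proj₂ (glue-Kn-occurrence adm′)))
    with L-part , XY-part ← ++-injective (map _ L) _ (map _ L′) _
                              (trans (List.length-map _ L) (trans |L|≡ (sym (List.length-map _ L′)))) glue≡
    with refl , Y-part ← ++-injective X _ X′ _
                           (ℕ.+-cancelˡ-≡ (length L) _ _ (trans |L|+|X|≡ (cong (_+ length X′) (sym |L|≡)))) XY-part
    = List.map-injective (ℕ.+-cancelˡ-≡ _ _ _) (subst (λ k → map (k +_) L ≡ _) (cong length XY-part) L-part)
    , refl
    , List.map-injective (ℕ.+-cancelˡ-≡ _ _ _) Y-part

  unshift : ∀ c xs → Unique xs → All (λ v → c < v × v ≤ c + length xs) xs →
            IsPerm (length (map (_∸ c) xs)) (map (_∸ c) xs) × map (c +_) (map (_∸ c) xs) ≡ xs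
  unshift c xs u bounds = isPerm refl (Unique.map⁻ (subst Unique (sym shift∘unshift) u))
                                 (All.map⁺ (All.map in-range bounds))
                        , shift∘unshift
    where
    shift∘unshift : map (c +_) (map (_∸ c) xs) ≡ xs
    shift∘unshift =
      trans (sym (List.map-∘ xs)) (List.map-id-local (All.map (λ (c<v , _) → ℕ.m+[n∸m]≡n (ℕ.<⇒≤ c<v)) bounds))
    in-range : ∀ {v} → c < v × v ≤ c + length xs → InRange (length (map (_∸ c) xs)) (v ∸ c)
    in-range {v} (c<v , v≤c+n) =
      ℕ.m<n⇒0<n∸m c<v , subst (v ∸ c ≤_) (sym (List.length-map (_∸ c) xs)) (ℕ.m≤n+o⇒m∸n≤o v c v≤c+n)

  private
    adjacent-not-king : ∀ a M b R → isKing (a ∷ M ++ b ∷ R) ≡ true → b ≡ a + suc (length R) →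
                        ¬ (length M ≡ 0 × length R ≡ 0)
    adjacent-not-king a [] b [] king refl _ = contradiction (trans (sym a-far-b) a-near-b) λ ()
      where
      a-far-b : farApart a (a + 1) ≡ true
      a-far-b = proj₁ (∧-split (farApart a (a + 1)) king)
      a-near-b : farApart a (a + 1) ≡ false
      a-near-b = subst (λ b → farApart a b ≡ false) (ℕ.+-comm 1 a) (proj₁ (farApart-suc a))
    adjacent-not-king a (_ ∷ _) b R _ _ (() , _)
    adjacent-not-king a [] b (_ ∷ _) _ _ (_ , ())

    ≤-cycle⇒≡ : ∀ {u₀ u₁ u₂} → u₀ ≤ u₁ → u₁ ≤ u₂ → u₂ ≤ u₀ → u₀ ≡ u₁
    ≤-cycle⇒≡ u₀≤u₁ u₁≤u₂ u₂≤u₀ = ℕ.≤-antisym u₀≤u₁ (ℕ.≤-trans u₁≤u₂ u₂≤u₀)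

  module _ {n P a M b R} (perm : IsPerm n (blocks P a M b R)) (shape : OccurrenceBlocks P a M b R) where

    open OccurrenceBlocks shape

    private
      inRange : ∀ {v} → v ∈ blocks P a M b R → InRange n v
      inRange = All.lookup (IsPerm.inRange perm)
      a-range : InRange n a
      a-range = inRange (∈-++⁺ʳ P (here refl))
      b-range : InRange n b
      b-range = inRange (∈-++⁺ʳ P (there (∈-++⁺ʳ M (here refl))))
      P-unique : Unique P
      P-unique = proj₁ (Unique-++⁻ P (IsPerm.unique perm))
      aMbR-unique : Unique (a ∷ M ++ b ∷ R)
      aMbR-unique = proj₂ (Unique-++⁻ P (IsPerm.unique perm))
      M-unique : Unique M
      M-unique = proj₁ (Unique-++⁻ M (AllPairs.tail aMbR-unique))
      R-unique : Unique R
      R-unique = AllPairs.tail (proj₂ (Unique-++⁻ M (AllPairs.tail aMbR-unique)))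

    -- Pigeonhole: P, M and R lie in the value ranges (b, n], (0, a) and (a, b), and with a and b
    -- they account for all n letters, so each range is full.
    block-sizes : a ≡ suc (length M) × b ≡ a + suc (length R) × n ≡ b + length P
    block-sizes = sym (ℕ.+-cancelʳ-≡ (suc (length R)) _ _ (ℕ.+-cancelˡ-≡ (length P) _ _ u₀≡u₁))
                , sym (ℕ.+-cancelˡ-≡ (length P) _ _ u₁≡u₂)
                , trans n≡u₀ (trans (trans u₀≡u₁ u₁≡u₂) (ℕ.+-comm (length P) b))
      where
      u₀ = length P + (suc (length M) + suc (length R))
      u₁ = length P + (a + suc (length R))
      u₂ = length P + b
      P-count : b + suc (length P) ≤ suc n
      P-count = Unique-between⇒length< (s≤s (proj₂ b-range)) P-unique
                  (All.tabulate λ v∈ → All.lookup P-above v∈ , s≤s (proj₂ (inRange (∈-++⁺ˡ v∈))))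
      M-count : suc (length M) ≤ a
      M-count = Unique-between⇒length< (proj₁ a-range) M-unique
                  (All.tabulate λ v∈ → proj₁ (inRange (∈-++⁺ʳ P (there (∈-++⁺ˡ v∈)))) , All.lookup M-below v∈)
      R-count : a + suc (length R) ≤ b
      R-count = Unique-between⇒length< a<b R-unique R-between
      n≡u₀ : n ≡ u₀
      n≡u₀ = trans (sym (IsPerm.length≡ perm))
                   (trans (length-blocks P a M b R) (ℕ.+-assoc (length P) (suc (length M)) (suc (length R))))
      u₂≤n : u₂ ≤ n
      u₂≤n = ℕ.≤-pred (subst (_≤ suc n) (trans (ℕ.+-suc b (length P)) (cong suc (ℕ.+-comm b (length P)))) P-count)
      u₀≤u₁ : u₀ ≤ u₁
      u₀≤u₁ = ℕ.+-monoʳ-≤ (length P) (ℕ.+-monoˡ-≤ (suc (length R)) M-count)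
      u₁≤u₂ : u₁ ≤ u₂
      u₁≤u₂ = ℕ.+-monoʳ-≤ (length P) R-count
      u₂≤u₀ : u₂ ≤ u₀
      u₂≤u₀ = subst (u₂ ≤_) n≡u₀ u₂≤n
      u₀≡u₁ : u₀ ≡ u₁
      u₀≡u₁ = ≤-cycle⇒≡ u₀≤u₁ u₁≤u₂ u₂≤u₀
      u₁≡u₂ : u₁ ≡ u₂
      u₁≡u₂ = ≤-cycle⇒≡ u₁≤u₂ u₂≤u₀ u₀≤u₁

    blocks-glue : isKing (blocks P a M b R) ≡ true →
                  ∃₂ λ L X → ∃ λ Y → Admissible L X Y × blocks P a M b R ≡ glue L X Y
    blocks-glue king
      with a≡ , b≡ , n≡ ← block-sizes
      with P-king , aMbR-king ← isKing-++⁻ P (a ∷ M ++ b ∷ R) king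
      with X-king , bR-king ← isKing-++⁻ (a ∷ M) (b ∷ R) aMbR-king
      with L-perm , P≡ ← unshift b P P-unique
             (All.tabulate λ v∈ → All.lookup P-above v∈ , subst (_ ≤_) n≡ (proj₂ (inRange (∈-++⁺ˡ v∈))))
      with Y-perm , bR≡ ← unshift a (b ∷ R) (proj₂ (Unique-++⁻ M (AllPairs.tail aMbR-unique)))
             ((a<b , ℕ.≤-reflexive b≡) ∷ All.map (λ (a<v , v<b) → a<v , ℕ.<⇒≤ (subst (_ <_) b≡ v<b)) R-between)
      = L , X , Y , record { L-king = L-king ; X-top = X-top ; Y-top = Y-top ; not-both-1 = not-both-1 } , sym glue≡
      where
      L = map (_∸ b) P
      X = a ∷ M
      Y = map (_∸ a) (b ∷ R)
      X-perm : IsPerm (length X) X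
      X-perm = isPerm refl (proj₁ (Unique-++⁻ (a ∷ M) aMbR-unique))
        ((proj₁ a-range , ℕ.≤-reflexive a≡) ∷ All.tabulate λ v∈ →
          proj₁ (inRange (∈-++⁺ʳ P (there (∈-++⁺ˡ v∈)))) , ℕ.<⇒≤ (subst (_ <_) a≡ (All.lookup M-below v∈)))
      L-king : L ∈ Kn (length L)
      L-king = ∈-Kn⁺ L-perm (trans (sym (isKing-+ b L)) (trans (cong isKing P≡) P-king))
      X-top : X ∈ KnTop (length X)
      X-top = ∈-KnTop⁺ X-perm X-king a≡
      Y-top : Y ∈ KnTop (length Y)
      Y-top = ∈-KnTop⁺ Y-perm (trans (sym (isKing-+ a Y)) (trans (cong isKing bR≡) bR-king))
                (trans (cong (_∸ a) b≡)
                       (trans (ℕ.m+n∸m≡n a (suc (length R))) (cong suc (sym (List.length-map (_∸ a) R)))))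
      not-both-1 : ¬ (length X ≡ 1 × length Y ≡ 1)
      not-both-1 (|X|≡1 , |Y|≡1) = adjacent-not-king a M b R aMbR-king b≡
        (ℕ.suc-injective |X|≡1 , trans (sym (List.length-map (_∸ a) R)) (ℕ.suc-injective |Y|≡1))
      |X⊕Y|≡b : length (directSum X Y) ≡ b
      |X⊕Y|≡b = trans (length-directSum X Y)
                      (trans (cong₂ _+_ (sym a≡) (cong suc (List.length-map (_∸ a) R))) (sym b≡))
      glue≡ : glue L X Y ≡ blocks P a M b R
      glue≡ = begin
        map (length (directSum X Y) +_) L ++ (X ++ map (length X +_) Y)
          ≡⟨ cong₂ (λ c d → map (c +_) L ++ (X ++ map (d +_) Y)) |X⊕Y|≡b (sym a≡) ⟩
        map (b +_) L ++ (X ++ map (a +_) Y)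
          ≡⟨ cong₂ (λ P′ bR → P′ ++ (X ++ bR)) P≡ bR≡ ⟩
        P ++ (a ∷ M ++ b ∷ R) ∎
        where open ≡-Reasoning

  decompose : ∀ {n σ} → σ ∈ Kn n → patCount Rp σ ≡ 1 → ∃₂ λ L X → ∃ λ Y → Admissible L X Y × σ ≡ glue L X Y
  decompose {n} {σ} σ∈ count≡1
    with perm , king ← ∈-Kn⁻ {n} σ∈
    with refl ← IsPerm.length≡ perm
    with p , q , occ ← patCount≡1⇒IsOccurrence perm count≡1
    with P , a , M , b , R , refl , refl , refl ← split-blocks σ (IsOccurrence.p<q occ) (IsOccurrence.q<n occ)
    = blocks-glue perm (IsOccurrence⇒OccurrenceBlocks P a M b R occ) king

  module _ {B : Set} where

    concatTo : ℕ → (ℕ → List B) → List B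
    concatTo zero    f = f 0
    concatTo (suc N) f = concatTo N f ++ f (suc N)

    ∈-concatTo⁻ : ∀ N f {z} → z ∈ concatTo N f → ∃ λ i → i ≤ N × z ∈ f i
    ∈-concatTo⁻ zero    f z∈ = 0 , z≤n , z∈
    ∈-concatTo⁻ (suc N) f z∈ with ∈-++⁻ (concatTo N f) z∈
    ... | inj₂ z∈fN = suc N , ℕ.≤-refl , z∈fN
    ... | inj₁ z∈′ with i , i≤N , z∈fi ← ∈-concatTo⁻ N f z∈′ = i , ℕ.m≤n⇒m≤1+n i≤N , z∈fi

    ∈-concatTo⁺ : ∀ N f {i z} → i ≤ N → z ∈ f i → z ∈ concatTo N f
    ∈-concatTo⁺ zero    f z≤n     z∈ = z∈
    ∈-concatTo⁺ (suc N) f {i} i≤N z∈ with ℕ.m≤n⇒m<n∨m≡n i≤N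
    ... | inj₁ i<N    = ∈-++⁺ˡ (∈-concatTo⁺ N f (ℕ.≤-pred i<N) z∈)
    ... | inj₂ refl   = ∈-++⁺ʳ (concatTo N f) z∈

    Unique-concatTo : ∀ N f (index : B → ℕ) → (∀ i → Unique (f i)) → (∀ {i z} → z ∈ f i → index z ≡ i) →
                      Unique (concatTo N f)
    Unique-concatTo zero    f index unique _      = unique 0
    Unique-concatTo (suc N) f index unique index≡ =
      Unique.++⁺ (Unique-concatTo N f index unique index≡) (unique (suc N)) disjoint
      where
      disjoint : ∀ {z} → ¬ (z ∈ concatTo N f × z ∈ f (suc N))
      disjoint (z∈ , z∈fN) with i , i≤N , z∈fi ← ∈-concatTo⁻ N f z∈ =
        ℕ.<-irrefl refl (subst (_≤ N) (trans (sym (index≡ z∈fi)) (index≡ z∈fN)) i≤N)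

  Triple : Set
  Triple = List ℕ × List ℕ × List ℕ

  glue₃ : Triple → List ℕ
  glue₃ (L , X , Y) = glue L X Y

  tripleBlock : ℕ → ℕ → ℕ → List Triple
  tripleBlock l m r =
    if (m ≡ᵇ 1) ∧ (r ≡ᵇ 1) then [] else cartesianProduct (Kn l) (cartesianProduct (KnTop m) (KnTop r))

  triples : ℕ → List Triple
  triples n = concatTo n (λ l → concatTo (n ∸ l) (λ m → tripleBlock l m (n ∸ l ∸ m)))

  ∈-tripleBlock⁻ : ∀ l m r {L X Y} → (L , X , Y) ∈ tripleBlock l m r →
                   L ∈ Kn l × X ∈ KnTop m × Y ∈ KnTop r × ¬ (m ≡ 1 × r ≡ 1)
  ∈-tripleBlock⁻ l m r t∈ with (m ≡ᵇ 1) ∧ (r ≡ᵇ 1) in both-1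
  ... | false with L∈ , XY∈ ← ∈-cartesianProduct⁻ (Kn l) _ t∈
              with X∈ , Y∈ ← ∈-cartesianProduct⁻ (KnTop m) (KnTop r) XY∈ =
    L∈ , X∈ , Y∈ , λ { (refl , refl) → contradiction both-1 λ () }

  ∈-tripleBlock⁺ : ∀ l m r {L X Y} → L ∈ Kn l → X ∈ KnTop m → Y ∈ KnTop r → ¬ (m ≡ 1 × r ≡ 1) →
                   (L , X , Y) ∈ tripleBlock l m r
  ∈-tripleBlock⁺ l m r L∈ X∈ Y∈ not-both-1 with (m ≡ᵇ 1) ∧ (r ≡ᵇ 1) in both-1
  ... | false = ∈-cartesianProduct⁺ L∈ (∈-cartesianProduct⁺ X∈ Y∈)
  ... | true  with m≡1 , r≡1 ← ∧-split (m ≡ᵇ 1) both-1 = contradiction (≡ᵇ⇒≡ m≡1 , ≡ᵇ⇒≡ r≡1) not-both-1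

  Unique-tripleBlock : ∀ l m r → Unique (tripleBlock l m r)
  Unique-tripleBlock l m r with (m ≡ᵇ 1) ∧ (r ≡ᵇ 1)
  ... | true  = []
  ... | false = Unique.cartesianProduct⁺ (Unique-Kn l) (Unique.cartesianProduct⁺ (Unique-KnTop m) (Unique-KnTop r))

  private
    length-Kn : ∀ {n σ} → σ ∈ Kn n → length σ ≡ n
    length-Kn {n} σ∈ = IsPerm.length≡ (proj₁ (∈-Kn⁻ {n} σ∈))

    length-KnTop : ∀ {m σ} → σ ∈ KnTop m → length σ ≡ m
    length-KnTop {m} σ∈ with _ , _ , perm , _ ← ∈-KnTop⁻ {m} σ∈ = IsPerm.length≡ perm

  ∈-triples⁻ : ∀ n {L X Y} → (L , X , Y) ∈ triples n → Admissible L X Y × length L + (length X + length Y) ≡ n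
  ∈-triples⁻ n {L} {X} {Y} t∈
    with l , l≤n , t∈′ ← ∈-concatTo⁻ n _ t∈
    with m , m≤n-l , t∈″ ← ∈-concatTo⁻ (n ∸ l) _ t∈′
    with L∈ , X∈ , Y∈ , not-both-1 ← ∈-tripleBlock⁻ l m (n ∸ l ∸ m) t∈″
    with refl ← length-Kn {l} L∈
    with refl ← length-KnTop {m} X∈
    with |Y|≡ ← length-KnTop {n ∸ l ∸ m} Y∈
    = record { L-king = L∈ ; X-top = X∈ ; Y-top = subst (λ r → Y ∈ KnTop r) (sym |Y|≡) Y∈
             ; not-both-1 = subst (λ r → ¬ (length X ≡ 1 × r ≡ 1)) (sym |Y|≡) not-both-1 }
    , trans (cong (λ r → l + (m + r)) |Y|≡) (trans (cong (l +_) (ℕ.m+[n∸m]≡n m≤n-l)) (ℕ.m+[n∸m]≡n l≤n))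

  ∈-triples⁺ : ∀ n {L X Y} → Admissible L X Y → length L + (length X + length Y) ≡ n → (L , X , Y) ∈ triples n
  ∈-triples⁺ n {L} {X} {Y} adm refl =
    ∈-concatTo⁺ n _ (ℕ.m≤m+n (length L) _)
      (∈-concatTo⁺ (n ∸ length L) _ (subst (length X ≤_) |X|+|Y|≡ (ℕ.m≤m+n (length X) _))
        (subst (λ r → (L , X , Y) ∈ tripleBlock (length L) (length X) r) |Y|≡
          (∈-tripleBlock⁺ (length L) (length X) (length Y) L-king X-top Y-top not-both-1)))
    where
    open Admissible adm
    |X|+|Y|≡ : length X + length Y ≡ n ∸ length L
    |X|+|Y|≡ = sym (ℕ.m+n∸m≡n (length L) _)
    |Y|≡ : length Y ≡ n ∸ length L ∸ length X
    |Y|≡ = trans (sym (ℕ.m+n∸m≡n (length X) (length Y))) (cong (_∸ length X) |X|+|Y|≡)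

  Unique-triples : ∀ n → Unique (triples n)
  Unique-triples n = Unique-concatTo n _ (λ (L , _ , _) → length L)
    (λ l → Unique-concatTo (n ∸ l) _ (λ (_ , X , _) → length X) (λ m → Unique-tripleBlock l m (n ∸ l ∸ m))
             (λ {m} t∈ → length-KnTop {m} (proj₁ (proj₂ (∈-tripleBlock⁻ l m (n ∸ l ∸ m) t∈)))))
    (λ {l} t∈ → let m , _ , t∈′ = ∈-concatTo⁻ (n ∸ l) _ t∈ in
                length-Kn {l} (proj₁ (∈-tripleBlock⁻ l m (n ∸ l ∸ m) t∈′)))

  kingDist-1 : ∀ n → kingDist n 1 ≡ length (triples n)
  kingDist-1 n = trans
    (Unique-⊆⊇⇒length≡ (Unique.filter⁺ one? (Unique-Kn n))
                       (Unique-map-injectiveOn glue₃ (Unique-triples n) glue₃-injective) ⊆glued glued⊆)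
    (List.length-map glue₃ (triples n))
    where
    one? = λ σ → (patCount Rp σ ≡ᵇ 1) Bool.≟ true
    glue₃-injective : ∀ {s t} → s ∈ triples n → t ∈ triples n → glue₃ s ≡ glue₃ t → s ≡ t
    glue₃-injective {L , X , Y} {L′ , X′ , Y′} s∈ t∈ glue≡
      with refl , refl , refl ← glue-injective (proj₁ (∈-triples⁻ n s∈)) (proj₁ (∈-triples⁻ n t∈)) glue≡ = refl
    ⊆glued : ∀ {σ} → σ ∈ filter one? (Kn n) → σ ∈ map glue₃ (triples n)
    ⊆glued σ∈ with σ∈Kn , count ← ∈-filter⁻ one? {xs = Kn n} σ∈
              with L , X , Y , adm , refl ← decompose {n} σ∈Kn (≡ᵇ⇒≡ count) =
      ∈-map⁺ glue₃ (∈-triples⁺ n adm (trans (sym (length-glue L X Y)) (length-Kn {n} σ∈Kn)))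
    glued⊆ : ∀ {σ} → σ ∈ map glue₃ (triples n) → σ ∈ filter one? (Kn n)
    glued⊆ σ∈ with (L , X , Y) , t∈ , refl ← ∈-map⁻ glue₃ σ∈
              with adm , |LXY|≡n ← ∈-triples⁻ n t∈
              with glue∈ , occ ← glue-Kn-occurrence adm
              with refl ← |LXY|≡n =
      ∈-filter⁺ one? glue∈ (≡⇒≡ᵇ (patCount≡1 (∈-Kn⇒IsPerm {n} glue∈) occ))

  kingDist-0+1 : ∀ n → kingDist n 0 + kingDist n 1 ≡ length (Kn n)
  kingDist-0+1 n = length-filter-complement (λ σ → patCount Rp σ ≡ᵇ 0) (λ σ → patCount Rp σ ≡ᵇ 1) (Kn n) at-most-one
    where
    at-most-one : ∀ {σ} → σ ∈ Kn n → (patCount Rp σ ≡ᵇ 1) ≡ not (patCount Rp σ ≡ᵇ 0)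
    at-most-one {σ} σ∈ with patCount Rp σ | patCount≤1 (∈-Kn⇒IsPerm {n} σ∈)
    ... | 0 | _         = refl
    ... | 1 | _         = refl
    ... | 2+ _ | s≤s ()

  kingDist-2+ : ∀ n k → kingDist n (2 + k) ≡ 0
  kingDist-2+ n k = cong length (List.filter-none _ (All.tabulate none))
    where
    none : ∀ {σ} → σ ∈ Kn n → ¬ ((patCount Rp σ ≡ᵇ 2 + k) ≡ true)
    none {σ} σ∈ with patCount Rp σ | patCount≤1 (∈-Kn⇒IsPerm {n} σ∈)
    ... | 0 | _         = λ ()
    ... | 1 | _         = λ ()
    ... | 2+ _ | s≤s ()

open PowerSeries
open KingPermutations
open import Data.Nat as ℕ using (zero; suc; _∸_; _≡ᵇ_)
open import Data.Integer using (+_; _+_; _*_; -_; _-_)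
import Data.Integer.Properties as ℤ
open import Data.Integer.Solver using (module +-*-Solver)
open import Data.Bool using (true; false; _∧_)
open import Data.Product using (_,_; proj₁; proj₂)
open import Data.List using (List; length; cartesianProduct; _++_)
import Data.List.Properties as List
open import Relation.Binary.PropositionalEquality

length-concatTo : ∀ {B : Set} N (f : ℕ → List B) → + length (concatTo N f) ≡ sumTo N (λ i → + length (f i))
length-concatTo zero    f = refl
length-concatTo (suc N) f = begin
  + length (concatTo N f ++ f (suc N))                      ≡⟨ cong +_ (List.length-++ (concatTo N f)) ⟩
  + (length (concatTo N f) ℕ.+ length (f (suc N)))          ≡⟨ ℤ.pos-+ (length (concatTo N f)) _ ⟩
  + length (concatTo N f) + + length (f (suc N))            ≡⟨ cong (_+ + length (f (suc N))) (length-concatTo N f) ⟩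
  sumTo N (λ i → + length (f i)) + + length (f (suc N))     ∎
  where open ≡-Reasoning

t² Q t²Q : Series
t² = tS ⊗ tS
Q = A ⊗ A ⊗ inv1pt²
t²Q = tS ⊗ tS ⊗ A ⊗ A ⊗ inv1pt²

D : Series
D m = + length (KnTop m)

1+t-⊗-D : 1+t ⊗ D ≗ tS ⊗ A
1+t-⊗-D zero    = 1+t-⊗-zero D
1+t-⊗-D (suc n) = begin
  (1+t ⊗ D) (suc n)                                   ≡⟨ 1+t-⊗-suc D n ⟩
  D (suc n) + D n                                     ≡⟨ ℤ.pos-+ (length (KnTop (suc n))) (length (KnTop n)) ⟨
  + (length (KnTop (suc n)) ℕ.+ length (KnTop n))     ≡⟨ cong +_ (length-KnTop-suc n) ⟩
  A n                                                 ≡⟨ tS-⊗-suc A n ⟨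
  (tS ⊗ A) (suc n)                                    ∎
  where open ≡-Reasoning

D⊗D : D ⊗ D ≗ t²Q
D⊗D = begin
  D ⊗ D                                     ≈⟨ ⊗-cong {D} {sgn ⊗ (tS ⊗ A)} {D} {sgn ⊗ (tS ⊗ A)} D≗ D≗ ⟩
  (sgn ⊗ (tS ⊗ A)) ⊗ (sgn ⊗ (tS ⊗ A))       ≈⟨ ⊗-interchange sgn (tS ⊗ A) sgn (tS ⊗ A) ⟩
  (sgn ⊗ sgn) ⊗ ((tS ⊗ A) ⊗ (tS ⊗ A))       ≈⟨ ⊗-congˡ ((tS ⊗ A) ⊗ (tS ⊗ A)) inv1pt²≗sgn⊗sgn ⟨
  inv1pt² ⊗ ((tS ⊗ A) ⊗ (tS ⊗ A))           ≈⟨ ⊗-comm inv1pt² ((tS ⊗ A) ⊗ (tS ⊗ A)) ⟩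
  ((tS ⊗ A) ⊗ (tS ⊗ A)) ⊗ inv1pt²           ≈⟨ ⊗-congˡ inv1pt² (⊗-interchange tS A tS A) ⟩
  (t² ⊗ (A ⊗ A)) ⊗ inv1pt²                 ≈⟨ ⊗-congˡ inv1pt² (⊗-assoc t² A A) ⟨
  t²Q                                       ∎
  where
  open ≗-Reasoning
  D≗ : D ≗ sgn ⊗ (tS ⊗ A)
  D≗ = 1+t-⊗⁻¹ D (tS ⊗ A) 1+t-⊗-D

tS*tS≡0 : ∀ m r → (m ≡ᵇ 1) ∧ (r ≡ᵇ 1) ≡ false → tS m * tS r ≡ + 0
tS*tS≡0 zero          r             _ = refl
tS*tS≡0 (suc (suc m)) r             _ = refl
tS*tS≡0 (suc zero)    zero          _ = refl
tS*tS≡0 (suc zero)    (suc (suc r)) _ = refl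

length-tripleBlock : ∀ l m r → + length (tripleBlock l m r) ≡ A l * (D m * D r - tS m * tS r)
length-tripleBlock l m r with (m ≡ᵇ 1) ∧ (r ≡ᵇ 1) in both-1
... | true
  with refl ← ≡ᵇ⇒≡ {m} (proj₁ (∧-split (m ≡ᵇ 1) both-1))
  with refl ← ≡ᵇ⇒≡ {r} (proj₂ (∧-split (m ≡ᵇ 1) both-1)) = sym (ℤ.*-zeroʳ (A l))
... | false = begin
  + length (cartesianProduct (Kn l) (cartesianProduct (KnTop m) (KnTop r)))
    ≡⟨ cong +_ (trans (length-cartesianProduct (Kn l) _)
                      (cong (length (Kn l) ℕ.*_) (length-cartesianProduct (KnTop m) (KnTop r)))) ⟩
  + (length (Kn l) ℕ.* (length (KnTop m) ℕ.* length (KnTop r)))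
    ≡⟨ trans (ℤ.pos-* (length (Kn l)) _) (cong (A l *_) (ℤ.pos-* (length (KnTop m)) (length (KnTop r)))) ⟩
  A l * (D m * D r)
    ≡⟨ cong (A l *_) (ℤ.+-identityʳ (D m * D r)) ⟨
  A l * (D m * D r - + 0)
    ≡⟨ cong (λ x → A l * (D m * D r - x)) (tS*tS≡0 m r both-1) ⟨
  A l * (D m * D r - tS m * tS r) ∎
  where open ≡-Reasoning

H : Series
H n = + kingDist n 1

H≗A⊗[D⊗D⊖t²] : H ≗ A ⊗ (D ⊗ D ⊖ t²)
H≗A⊗[D⊗D⊖t²] n = begin
  + kingDist n 1
    ≡⟨ cong +_ (kingDist-1 n) ⟩
  + length (triples n)
    ≡⟨ length-concatTo n _ ⟩
  sumTo n (λ l → + length (concatTo (n ∸ l) (λ m → tripleBlock l m (n ∸ l ∸ m))))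
    ≡⟨ sumTo-cong n (λ l _ → length-concatTo (n ∸ l) _) ⟩
  sumTo n (λ l → sumTo (n ∸ l) (λ m → + length (tripleBlock l m (n ∸ l ∸ m))))
    ≡⟨ sumTo-cong n (λ l _ → sumTo-cong (n ∸ l) (λ m _ → length-tripleBlock l m (n ∸ l ∸ m))) ⟩
  sumTo n (λ l → sumTo (n ∸ l) (λ m → A l * (D m * D (n ∸ l ∸ m) - tS m * tS (n ∸ l ∸ m))))
    ≡⟨ sumTo-cong n (λ l _ → trans (sumTo-*ˡ (n ∸ l) (A l) _) (cong (A l *_) (sumTo-minus (n ∸ l) _ _))) ⟩
  (A ⊗ (D ⊗ D ⊖ t²)) n ∎
  where open ≡-Reasoning

P≗A⊖H : P ≗ A ⊖ H
P≗A⊖H n = begin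
  P n                                      ≡⟨ add-sub (P n) (H n) ⟩
  P n + H n - H n                          ≡⟨ cong (_- H n) (ℤ.pos-+ (kingDist n 0) (kingDist n 1)) ⟨
  + (kingDist n 0 ℕ.+ kingDist n 1) - H n  ≡⟨ cong (λ k → + k - H n) (kingDist-0+1 n) ⟩
  A n - H n                                ∎
  where
  open ≡-Reasoning
  open +-*-Solver
  add-sub : ∀ x y → x ≡ x + y - y
  add-sub = solve 2 (λ x y → x := x :+ y :- y) refl

H≗[t²Q⊖t²]⊗A : H ≗ (t²Q ⊖ t²) ⊗ A
H≗[t²Q⊖t²]⊗A = begin
  H                        ≈⟨ H≗A⊗[D⊗D⊖t²] ⟩
  A ⊗ (D ⊗ D ⊖ t²)         ≈⟨ ⊗-congʳ A (⊖-cong {g = t²} D⊗D (λ _ → refl)) ⟩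
  A ⊗ (t²Q ⊖ t²)           ≈⟨ ⊗-comm A (t²Q ⊖ t²) ⟩
  (t²Q ⊖ t²) ⊗ A           ∎
  where open ≗-Reasoning

P-formula : P ≗ (one ⊕ t² ⊖ t²Q) ⊗ A
P-formula n = begin
  P n                                         ≡⟨ P≗A⊖H n ⟩
  A n - H n
    ≡⟨ cong (λ h → A n - h) (trans (H≗[t²Q⊖t²]⊗A n) (⊗-distribʳ-⊖ t²Q t² A n)) ⟩
  A n - ((t²Q ⊗ A) n - (t² ⊗ A) n)            ≡⟨ regroup (A n) ((t²Q ⊗ A) n) ((t² ⊗ A) n) ⟩
  A n + (t² ⊗ A) n - (t²Q ⊗ A) n              ≡⟨ cong (λ x → x + (t² ⊗ A) n - (t²Q ⊗ A) n) (⊗-identityˡ A n) ⟨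
  (one ⊗ A) n + (t² ⊗ A) n - (t²Q ⊗ A) n      ≡⟨ cong (_- (t²Q ⊗ A) n) (⊗-distribʳ-⊕ one t² A n) ⟨
  ((one ⊕ t²) ⊗ A) n - (t²Q ⊗ A) n            ≡⟨ ⊗-distribʳ-⊖ (one ⊕ t²) t²Q A n ⟨
  ((one ⊕ t² ⊖ t²Q) ⊗ A) n                    ∎
  where
  open ≡-Reasoning
  open +-*-Solver
  regroup : ∀ a q t → a - (q - t) ≡ a + t - q
  regroup = solve 3 (λ a q t → a :- (q :- t) := a :+ t :- q) refl

1-u : BSeries
1-u = ι one ⊖₂ uS

E-formula-column : ∀ k → column ((ι one ⊕₂ ι t² ⊗₂ 1-u ⊗₂ (ι one ⊖₂ ι Q)) ⊗₂ ι A) k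
                         ≗ (column (ι one) k ⊕ (t² ⊗ column 1-u k) ⊗ (one ⊖ Q)) ⊗ A
E-formula-column k = begin
  column ((ι one ⊕₂ F) ⊗₂ ι A) k
    ≈⟨ column-⊗₂-u-freeʳ (ι one ⊕₂ F) (ι A) (λ _ _ → refl) k ⟩
  (column (ι one) k ⊕ column F k) ⊗ A
    ≈⟨ ⊗-congˡ A (⊕-congʳ (column (ι one) k)
                   (column-⊗₂-u-freeʳ (ι t² ⊗₂ 1-u) (ι one ⊖₂ ι Q) (λ _ _ → refl) k)) ⟩
  (column (ι one) k ⊕ column (ι t² ⊗₂ 1-u) k ⊗ (one ⊖ Q)) ⊗ A
    ≈⟨ ⊗-congˡ A (⊕-congʳ (column (ι one) k)
                   (⊗-congˡ (one ⊖ Q) (column-⊗₂-u-freeˡ (ι t²) 1-u (λ _ _ → refl) k))) ⟩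
  (column (ι one) k ⊕ (t² ⊗ column 1-u k) ⊗ (one ⊖ Q)) ⊗ A ∎
  where
  open ≗-Reasoning
  F = ι t² ⊗₂ 1-u ⊗₂ (ι one ⊖₂ ι Q)

t²⊗[1⊖Q] : t² ⊗ (one ⊖ Q) ≗ t² ⊖ t²Q
t²⊗[1⊖Q] = begin
  t² ⊗ (one ⊖ Q)                 ≈⟨ ⊗-distribˡ-⊖ t² one Q ⟩
  t² ⊗ one ⊖ t² ⊗ Q              ≈⟨ ⊖-cong {g = t² ⊗ Q} (⊗-identityʳ t²) (λ _ → refl) ⟩
  t² ⊖ t² ⊗ Q                    ≈⟨ ⊖-cong {t²} (λ _ → refl) t²⊗Q≗t²Q ⟩
  t² ⊖ t²Q                       ∎
  where
  open ≗-Reasoning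
  t²⊗Q≗t²Q : t² ⊗ Q ≗ t²Q
  t²⊗Q≗t²Q = begin
    t² ⊗ ((A ⊗ A) ⊗ inv1pt²)     ≈⟨ ⊗-assoc t² (A ⊗ A) inv1pt² ⟨
    (t² ⊗ (A ⊗ A)) ⊗ inv1pt²     ≈⟨ ⊗-congˡ inv1pt² (⊗-assoc t² A A) ⟨
    t²Q                          ∎

E-column : ∀ k → (λ n → E n k) ≗ (column (ι one) k ⊕ (t² ⊗ column 1-u k) ⊗ (one ⊖ Q)) ⊗ A
E-column zero = begin
  P                                                  ≈⟨ P-formula ⟩
  (one ⊕ t² ⊖ t²Q) ⊗ A                               ≈⟨ ⊗-congˡ A (λ n → ℤ.+-assoc (one n) (t² n) (- t²Q n)) ⟩
  (one ⊕ (t² ⊖ t²Q)) ⊗ A                             ≈⟨ ⊗-congˡ A (⊕-congʳ one t²⊗[1⊖Q]) ⟨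
  (one ⊕ t² ⊗ (one ⊖ Q)) ⊗ A                         ≈⟨ ⊗-congˡ A (⊕-congʳ one (⊗-congˡ (one ⊖ Q) t²⊗column₀)) ⟨
  (one ⊕ (t² ⊗ column 1-u 0) ⊗ (one ⊖ Q)) ⊗ A        ∎
  where
  open ≗-Reasoning
  column₀ : column 1-u 0 ≗ one
  column₀ zero    = refl
  column₀ (suc n) = refl
  t²⊗column₀ : t² ⊗ column 1-u 0 ≗ t²
  t²⊗column₀ n = trans (⊗-congʳ t² column₀ n) (⊗-identityʳ t² n)
E-column (suc zero) = begin
  H                                                          ≈⟨ H≗[t²Q⊖t²]⊗A ⟩
  (t²Q ⊖ t²) ⊗ A                                             ≈⟨ ⊗-congˡ A (λ n → swap-minus (t²Q n) (t² n)) ⟩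
  neg (t² ⊖ t²Q) ⊗ A                                         ≈⟨ ⊗-congˡ A (λ n → cong -_ (t²⊗[1⊖Q] n)) ⟨
  neg (t² ⊗ (one ⊖ Q)) ⊗ A                                   ≈⟨ ⊗-congˡ A (⊗-negˡ t² (one ⊖ Q)) ⟨
  (neg t² ⊗ (one ⊖ Q)) ⊗ A                                   ≈⟨ ⊗-congˡ A (⊗-congˡ (one ⊖ Q) t²⊗column₁) ⟨
  ((t² ⊗ column 1-u 1) ⊗ (one ⊖ Q)) ⊗ A                      ≈⟨ ⊗-congˡ A (λ n → ℤ.+-identityˡ (G n)) ⟨
  (column (ι one) 1 ⊕ (t² ⊗ column 1-u 1) ⊗ (one ⊖ Q)) ⊗ A   ∎
  where
  open ≗-Reasoning
  open +-*-Solver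
  swap-minus : ∀ x y → x - y ≡ - (y - x)
  swap-minus = solve 2 (λ x y → x :- y := :- (y :- x)) refl
  G = (t² ⊗ column 1-u 1) ⊗ (one ⊖ Q)
  column₁ : column 1-u 1 ≗ neg one
  column₁ zero    = refl
  column₁ (suc n) = refl
  t²⊗column₁ : t² ⊗ column 1-u 1 ≗ neg t²
  t²⊗column₁ = begin
    t² ⊗ column 1-u 1      ≈⟨ ⊗-congʳ t² column₁ ⟩
    t² ⊗ neg one           ≈⟨ ⊗-comm t² (neg one) ⟩
    neg one ⊗ t²           ≈⟨ ⊗-negˡ one t² ⟩
    neg (one ⊗ t²)         ≈⟨ (λ n → cong -_ (⊗-identityˡ t² n)) ⟩
    neg t²                 ∎
E-column (suc (suc k)) n = begin
  + kingDist n (suc (suc k))        ≡⟨ cong +_ (kingDist-2+ n k) ⟩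
  + 0                               ≡⟨ ⊗-zeroˡ _ A (λ m → trans (ℤ.+-identityˡ _) (⊗-zeroˡ _ (one ⊖ Q) t²⊗column₂₊ m)) n ⟨
  ((column (ι one) (suc (suc k)) ⊕ (t² ⊗ column 1-u (suc (suc k))) ⊗ (one ⊖ Q)) ⊗ A) n ∎
  where
  open ≡-Reasoning
  column₂₊ : column 1-u (suc (suc k)) ≗ (λ _ → + 0)
  column₂₊ zero    = refl
  column₂₊ (suc _) = refl
  t²⊗column₂₊ : t² ⊗ column 1-u (suc (suc k)) ≗ (λ _ → + 0)
  t²⊗column₂₊ m = trans (⊗-comm t² (column 1-u (suc (suc k))) m) (⊗-zeroˡ (column 1-u (suc (suc k))) t² column₂₊ m)

theorem3p7 : ((n : ℕ) → P n ≡ ((one ⊕ tS ⊗ tS ⊖ tS ⊗ tS ⊗ A ⊗ A ⊗ inv1pt²) ⊗ A) n)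
           × ((n k : ℕ) → E n k ≡ ((ι one ⊕₂ ι (tS ⊗ tS) ⊗₂ (ι one ⊖₂ uS) ⊗₂ (ι one ⊖₂ ι (A ⊗ A ⊗ inv1pt²))) ⊗₂ ι A) n k)
theorem3p7 = P-formula , λ n k → trans (E-column k n) (sym (E-formula-column k n))
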